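{- Let $A_n\in\mathbb{Z}/2[t]$, $n>0$ odd, satisfy $A_{n+16}=t^{16}A_n+t^4A_{n+4}+t^2A_{n+2}$, with $A_1,A_3,A_5,A_7,A_9,A_{11},A_{13},A_{15}$ equal to $0,\ t,\ 0,\ t^5,\ t^3,\ t^9+t,\ t^7,\ t^{13}+t^5$ respectively. Then, writing $t^n=[a,b]$: if $a>0$, $A_n=[a-1,b]+$ a sum of monomials preceding $[a-1,b]$; if $a=0$, $A_n$ is a sum of monomials each equal to or preceding $[0,b-1]$.
   Context: Let $g:\mathbb{N}\to\mathbb{N}$ be defined by $g(0)=0$, $g(2n)=4g(n)$, $g(2n+1)=g(2n)+1$. For $a,b\in\mathbb{N}$, $[a,b]$ denotes $t^{1+2g(a)+4g(b)}$; every $t^k$ with $k$ odd positive is uniquely of this form. Say $[c,d]$ precedes $[a,b]$ if $c+d<a+b$, or $c+d=a+b$ and $d<b$. "A sum of monomials" means a finite (possibly empty, i.e. $0$) sum of distinct monomials; when $b=0$ no monomial is equal to or preceding $[0,b-1]$, so the conclusion then means $A_n=0$. -}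

module Defs where

open import Data.Nat using (ℕ; zero; suc; _+_; _*_; _<_; _/_; _%_)
open import Data.Bool using (Bool; true; false; _xor_)
open import Data.List using (List; []; _∷_; replicate; _++_)
open import Data.Product using (_×_; _,_; ∃-syntax)
open import Data.Sum using (_⊎_)
open import Relation.Binary.PropositionalEquality using (_≡_)

-- Polynomials in (Z/2)[t]: coefficient lists, lowest degree first.
Poly : Set
Poly = List Bool

coeff : Poly → ℕ → Bool
coeff []      _       = false
coeff (b ∷ p) zero    = b
coeff (b ∷ p) (suc k) = coeff p k

-- equality of polynomials (ignores trailing zero coefficients)
infix 4 _≈ₚ_
_≈ₚ_ : Poly → Poly → Set
p ≈ₚ q = ∀ k → coeff p k ≡ coeff q k

infixl 6 _⊕_
_⊕_ : Poly → Poly → Poly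
[]      ⊕ q       = q
(a ∷ p) ⊕ []      = a ∷ p
(a ∷ p) ⊕ (b ∷ q) = (a xor b) ∷ (p ⊕ q)

shift : ℕ → Poly → Poly
shift k p = replicate k false ++ p

mono : ℕ → Poly
mono k = shift k (true ∷ [])

-- g(0)=0, g(2n)=4g(n), g(2n+1)=g(2n)+1, computed with fuel
-- (fuel n suffices since n / 2 < n for n > 0).
gAux : ℕ → ℕ → ℕ
gAux zero    n = 0
gAux (suc f) n = 4 * gAux f (n / 2) + n % 2

g : ℕ → ℕ
g n = gAux n n

-- [a,b] as an exponent: t^[a,b] = t^(1 + 2 g(a) + 4 g(b))
br : ℕ → ℕ → ℕ
br a b = 1 + 2 * g a + 4 * g b

Precedes : ℕ × ℕ → ℕ × ℕ → Set
Precedes (c , d) (a , b) = (c + d < a + b) ⊎ ((c + d ≡ a + b) × (d < b))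

-- the recurrence and initial values for the family A (indexed by all n,
-- only odd indices constrained)
Hyp : (ℕ → Poly) → Set
Hyp A =
  (∀ m → A (2 * m + 1 + 16) ≈ₚ
           shift 16 (A (2 * m + 1)) ⊕ shift 4 (A (2 * m + 1 + 4))
             ⊕ shift 2 (A (2 * m + 1 + 2)))
  × A 1  ≈ₚ []
  × A 3  ≈ₚ mono 1
  × A 5  ≈ₚ []
  × A 7  ≈ₚ mono 5
  × A 9  ≈ₚ mono 3
  × A 11 ≈ₚ mono 9 ⊕ mono 1
  × A 13 ≈ₚ mono 7
  × A 15 ≈ₚ mono 13 ⊕ mono 5

-- Encode the family as the power series F = Σ Aₙ(y) xⁿ (n odd) over 𝔽₂. The recurrence and the
-- initial values say that D · F = P for D = 1 + x¹²y⁴ + x¹⁴y² + x¹⁶y¹⁶ and a polynomial P. Since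
-- D · D = D(x², y²) in characteristic 2, the section Λᵣₛ G = Σ G₂ᵢ₊ᵣ,₂ⱼ₊ₛ xⁱyʲ of N / D is
-- Λᵣₛ(D · N) / D, so the coefficient of xⁿyᵏ in F is computed by an automaton reading the binary
-- digits of n and k, whose states are the 69 numerators reachable from P.
-- The exponent [a,b] = 1 + 2 (g a + 2 g b) interleaves the binary digits of a and b, so for
-- n = [a,b] and k = [c,d] every two steps read one digit of each of a, b, c, d. A second, 9-state
-- automaton compares (c + d, d) with (a + b, b) lexicographically from the lowest digits up; a
-- table of admissible (numerator, comparison) pairs closed under the transitions shows that every
-- nonzero coefficient sits at some [c,d] equal to or preceding [a - 1, b], and a similar invariant
-- carrying the borrow of a - 1 shows that the coefficient at [a - 1, b] is 1. Even k never occur: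
-- after reading an odd n and an even k the numerator is 0.

module Submission where

open import Defs
open import Algebra.Bundles using (CommutativeRing)
open import Data.Bool using (Bool; true; false; _xor_; _∧_; _∨_; not; if_then_else_; T)
open import Data.Bool.ListAction using (any)
open import Data.Bool.Properties using (xor-assoc; xor-identityʳ; xor-same; ∧-zeroʳ; T-∧; T-≡; xor-∧-commutativeRing)
open import Algebra.Properties.CommutativeSemigroup
  (CommutativeRing.+-commutativeSemigroup xor-∧-commutativeRing) using (interchange; x∙yz≈y∙xz)
open import Data.Empty using (⊥-elim)
open import Data.List using (List; []; _∷_; _++_; map; concatMap; foldr)
import Data.List.Properties as List
open import Data.List.Relation.Unary.All using (All; []; _∷_)
open import Data.Maybe using (Maybe; just; nothing)
open import Data.Nat using (ℕ; zero; suc; _+_; _*_; _≤_; _<_; _≤ᵇ_; _≡ᵇ_; _<ᵇ_; _≟_; z≤n; _/_; _%_; ⌊_/2⌋)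
open import Data.Nat.DivMod.Core using (divₕ-extractAcc)
open import Data.Nat.Properties
  using ( ≡ᵇ⇒≡; ≤ᵇ⇒≤; <ᵇ⇒<; suc-injective; +-suc; +-comm; +-assoc; +-identityʳ; +-cancelʳ-≡; +-cancelʳ-≤
        ; +-monoʳ-≤; *-monoʳ-≤; ≤-refl; ≤-reflexive; ≤-trans; ≤-antisym; ≤-pred; ≤-<-trans; n≤1+n
        ; m≤m+n; m≤n+m; m≤n*m; m≤n⇒m<n∨m≡n; ⌊n/2⌋-mono; ⌊n/2⌋<n; module ≤-Reasoning )
open import Data.Nat.Tactic.RingSolver using (solve-∀)
open import Data.Product using (_×_; _,_; proj₁; proj₂; ∃-syntax)
import Data.Product.Properties as Product
open import Data.Sum using (_⊎_; inj₁; inj₂)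
open import Data.Unit using (tt)
open import Function.Base using (_∘_)
open import Function.Bundles using (Equivalence)
open import Relation.Binary.Bundles using (Setoid)
open import Relation.Binary.Definitions using (DecidableEquality)
open import Relation.Binary.PropositionalEquality
import Relation.Binary.Reasoning.Setoid as SetoidReasoning
open import Relation.Nullary using (contradiction)
open import Relation.Nullary.Decidable using (isYes; toWitness)

T-∧ˡ : ∀ {a b} → T (a ∧ b) → T a
T-∧ˡ = proj₁ ∘ Equivalence.to T-∧

T-∧ʳ : ∀ {a b} → T (a ∧ b) → T b
T-∧ʳ = proj₂ ∘ Equivalence.to T-∧

xor-cancelˡ : ∀ x y z → (x xor y) xor (y xor z) ≡ x xor z
xor-cancelˡ false false z     = refl
xor-cancelˡ false true  false = refl
xor-cancelˡ false true  true  = refl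
xor-cancelˡ true  false false = refl
xor-cancelˡ true  false true  = refl
xor-cancelˡ true  true  false = refl
xor-cancelˡ true  true  true  = refl

xor-cancel₃ : ∀ x y z → ((x xor y) xor z) xor (y xor (z xor (x xor false))) ≡ false
xor-cancel₃ false false false = refl
xor-cancel₃ false false true  = refl
xor-cancel₃ false true  false = refl
xor-cancel₃ false true  true  = refl
xor-cancel₃ true  false false = refl
xor-cancel₃ true  false true  = refl
xor-cancel₃ true  true  false = refl
xor-cancel₃ true  true  true  = refl

b2n : Bool → ℕ
b2n false = 0
b2n true  = 1

twice : ℕ → ℕ
twice zero    = zero
twice (suc n) = suc (suc (twice n))

consBit : Bool → ℕ → ℕ
consBit false n = twice n
consBit true  n = suc (twice n)

lowBit : ℕ → Bool
lowBit zero          = false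
lowBit (suc zero)    = true
lowBit (suc (suc n)) = lowBit n

consBit-lowBit-⌊/2⌋ : ∀ n → consBit (lowBit n) ⌊ n /2⌋ ≡ n
consBit-lowBit-⌊/2⌋ zero          = refl
consBit-lowBit-⌊/2⌋ (suc zero)    = refl
consBit-lowBit-⌊/2⌋ (suc (suc n)) with lowBit n | consBit-lowBit-⌊/2⌋ n
... | false | e = cong (λ m → suc (suc m)) e
... | true  | e = cong (λ m → suc (suc m)) e

⌊consBit/2⌋ : ∀ r n → ⌊ consBit r n /2⌋ ≡ n
⌊consBit/2⌋ false zero    = refl
⌊consBit/2⌋ false (suc n) = cong suc (⌊consBit/2⌋ false n)
⌊consBit/2⌋ true  zero    = refl
⌊consBit/2⌋ true  (suc n) = cong suc (⌊consBit/2⌋ true n)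

lowBit-consBit : ∀ r n → lowBit (consBit r n) ≡ r
lowBit-consBit false zero    = refl
lowBit-consBit false (suc n) = lowBit-consBit false n
lowBit-consBit true  zero    = refl
lowBit-consBit true  (suc n) = lowBit-consBit true n

twice≡+ : ∀ n → twice n ≡ n + n
twice≡+ zero    = refl
twice≡+ (suc n) = cong suc (trans (cong suc (twice≡+ n)) (sym (+-suc n n)))

data Binary : ℕ → Set where
  bits : ∀ r n → Binary (consBit r n)

binary : ∀ n → Binary n
binary n = subst Binary (consBit-lowBit-⌊/2⌋ n) (bits (lowBit n) ⌊ n /2⌋)

≤suc⇒⌊/2⌋≤ : ∀ {n f} → n ≤ suc f → ⌊ n /2⌋ ≤ f
≤suc⇒⌊/2⌋≤ {n} {f} le = ≤-pred (≤-<-trans (⌊n/2⌋-mono le) (⌊n/2⌋<n f))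

consBit≤suc⇒≤ : ∀ r {n f} → consBit r n ≤ suc f → n ≤ f
consBit≤suc⇒≤ r {n} le = subst (_≤ _) (⌊consBit/2⌋ r n) (≤suc⇒⌊/2⌋≤ le)

consBit≡ : ∀ r n → consBit r n ≡ b2n r + 2 * n
consBit≡ false n = trans (twice≡+ n) (cong (n +_) (sym (+-identityʳ n)))
consBit≡ true  n = cong suc (consBit≡ false n)

n≤consBit : ∀ r n → n ≤ consBit r n
n≤consBit r n = subst (n ≤_) (sym (consBit≡ r n)) (≤-trans (m≤n*m n 2) (m≤n+m _ (b2n r)))

-- Power series over 𝔽₂ in x, y

Series : Set
Series = ℕ → ℕ → Bool

infix 4 _≋_
_≋_ : Series → Series → Set
R ≋ S = ∀ p q → R p q ≡ S p q

infixr 6 _⊻_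
_⊻_ : Series → Series → Series
(R ⊻ S) p q = R p q xor S p q

0ˢ : Series
0ˢ p q = false

Monomial : Set
Monomial = ℕ × ℕ

_+ₘ_ : Monomial → Monomial → Monomial
(a , b) +ₘ (c , d) = (a + c , b + d)

double : Monomial → Monomial
double (a , b) = (twice a , twice b)

mulMono : Monomial → Series → Series
mulMono (suc a , b)     R zero    q       = false
mulMono (suc a , b)     R (suc p) q       = mulMono (a , b) R p q
mulMono (zero  , suc b) R p       zero    = false
mulMono (zero  , suc b) R p       (suc q) = mulMono (zero , b) R p q
mulMono (zero  , zero)  R p       q       = R p q

mul : List Monomial → Series → Series
mul []      R = 0ˢ
mul (m ∷ L) R = mulMono m R ⊻ mul L R

≋-setoid : Setoid _ _
≋-setoid = record
  { Carrier = Series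
  ; _≈_ = _≋_
  ; isEquivalence = record
    { refl = λ _ _ → refl
    ; sym = λ e p q → sym (e p q)
    ; trans = λ e f p q → trans (e p q) (f p q)
    }
  }

open Setoid ≋-setoid public using () renaming (refl to ≋-refl; sym to ≋-sym; trans to ≋-trans)

⊻-cong : ∀ {R R′ S S′} → R ≋ R′ → S ≋ S′ → R ⊻ S ≋ R′ ⊻ S′
⊻-cong e f p q = cong₂ _xor_ (e p q) (f p q)

mulMono-cong : ∀ m {R S} → R ≋ S → mulMono m R ≋ mulMono m S
mulMono-cong (suc a , b)     e zero    q       = refl
mulMono-cong (suc a , b)     e (suc p) q       = mulMono-cong (a , b) e p q
mulMono-cong (zero  , suc b) e p       zero    = refl
mulMono-cong (zero  , suc b) e p       (suc q) = mulMono-cong (zero , b) e p q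
mulMono-cong (zero  , zero)  e p       q       = e p q

mulMono-⊻ : ∀ m R S → mulMono m (R ⊻ S) ≋ mulMono m R ⊻ mulMono m S
mulMono-⊻ (suc a , b)     R S zero    q       = refl
mulMono-⊻ (suc a , b)     R S (suc p) q       = mulMono-⊻ (a , b) R S p q
mulMono-⊻ (zero  , suc b) R S p       zero    = refl
mulMono-⊻ (zero  , suc b) R S p       (suc q) = mulMono-⊻ (zero , b) R S p q
mulMono-⊻ (zero  , zero)  R S p       q       = refl

mulMono-0ˢ : ∀ m → mulMono m 0ˢ ≋ 0ˢ
mulMono-0ˢ (suc a , b)     zero    q       = refl
mulMono-0ˢ (suc a , b)     (suc p) q       = mulMono-0ˢ (a , b) p q
mulMono-0ˢ (zero  , suc b) p       zero    = refl
mulMono-0ˢ (zero  , suc b) p       (suc q) = mulMono-0ˢ (zero , b) p q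
mulMono-0ˢ (zero  , zero)  p       q       = refl

mulMono-mulMono : ∀ m n R → mulMono m (mulMono n R) ≋ mulMono (m +ₘ n) R
mulMono-mulMono (suc a , b) n R zero    q = refl
mulMono-mulMono (suc a , b) n R (suc p) q = mulMono-mulMono (a , b) n R p q
mulMono-mulMono (zero , suc b) (c , d) R p zero    = sym (vanish c p)
  where
  vanish : ∀ c p → mulMono (c , suc (b + d)) R p zero ≡ false
  vanish zero    p       = refl
  vanish (suc c) zero    = refl
  vanish (suc c) (suc p) = vanish c p
mulMono-mulMono (zero , suc b) (c , d) R p (suc q) =
  trans (mulMono-mulMono (zero , b) (c , d) R p q) (sym (peel c p))
  where
  peel : ∀ c p → mulMono (c , suc (b + d)) R p (suc q) ≡ mulMono (c , b + d) R p q
  peel zero    p       = refl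
  peel (suc c) zero    = refl
  peel (suc c) (suc p) = peel c p
mulMono-mulMono (zero , zero) n R p q = refl

mul-cong : ∀ L {R S} → R ≋ S → mul L R ≋ mul L S
mul-cong []      e = ≋-refl
mul-cong (m ∷ L) e = ⊻-cong (mulMono-cong m e) (mul-cong L e)

mul-0ˢ : ∀ L → mul L 0ˢ ≋ 0ˢ
mul-0ˢ []      p q = refl
mul-0ˢ (m ∷ L) p q = cong₂ _xor_ (mulMono-0ˢ m p q) (mul-0ˢ L p q)

mul-⊻ : ∀ L R S → mul L (R ⊻ S) ≋ mul L R ⊻ mul L S
mul-⊻ []      R S p q = refl
mul-⊻ (m ∷ L) R S p q =
  trans (cong₂ _xor_ (mulMono-⊻ m R S p q) (mul-⊻ L R S p q))
        (interchange (mulMono m R p q) (mulMono m S p q) (mul L R p q) (mul L S p q))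

+ₘ-comm : ∀ m n → m +ₘ n ≡ n +ₘ m
+ₘ-comm (a , b) (c , d) = cong₂ _,_ (+-comm a c) (+-comm b d)

mulMono-mul : ∀ m L R → mulMono m (mul L R) ≋ mul L (mulMono m R)
mulMono-mul m []       R = mulMono-0ˢ m
mulMono-mul m (n ∷ L)  R = begin
  mulMono m (mulMono n R ⊻ mul L R)             ≈⟨ mulMono-⊻ m _ _ ⟩
  mulMono m (mulMono n R) ⊻ mulMono m (mul L R) ≈⟨ ⊻-cong (mulMono-mulMono m n R) (mulMono-mul m L R) ⟩
  mulMono (m +ₘ n) R ⊻ mul L (mulMono m R)      ≡⟨ cong (λ k → mulMono k R ⊻ mul L (mulMono m R)) (+ₘ-comm m n) ⟩
  mulMono (n +ₘ m) R ⊻ mul L (mulMono m R)      ≈⟨ ⊻-cong (≋-sym (mulMono-mulMono n m R)) ≋-refl ⟩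
  mulMono n (mulMono m R) ⊻ mul L (mulMono m R) ∎
  where open SetoidReasoning ≋-setoid

m+ₘm≡double : ∀ m → m +ₘ m ≡ double m
m+ₘm≡double (a , b) = sym (cong₂ _,_ (twice≡+ a) (twice≡+ b))

frobenius : ∀ L R → mul L (mul L R) ≋ mul (map double L) R
frobenius []      R = ≋-refl
frobenius (m ∷ L) R = begin
  mulMono m (mulMono m R ⊻ mul L R) ⊻ mul L (mulMono m R ⊻ mul L R)
    ≈⟨ ⊻-cong (mulMono-⊻ m _ _) (mul-⊻ L _ _) ⟩
  (mulMono m (mulMono m R) ⊻ mulMono m (mul L R)) ⊻ (mul L (mulMono m R) ⊻ mul L (mul L R))
    ≈⟨ ⊻-cong (⊻-cong (≋-refl {mulMono m (mulMono m R)}) (mulMono-mul m L R)) ≋-refl ⟩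
  (mulMono m (mulMono m R) ⊻ mul L (mulMono m R)) ⊻ (mul L (mulMono m R) ⊻ mul L (mul L R))
    ≈⟨ (λ p q → xor-cancelˡ (mulMono m (mulMono m R) p q) (mul L (mulMono m R) p q) (mul L (mul L R) p q)) ⟩
  mulMono m (mulMono m R) ⊻ mul L (mul L R)
    ≈⟨ ⊻-cong (mulMono-mulMono m m R) (frobenius L R) ⟩
  mulMono (m +ₘ m) R ⊻ mul (map double L) R
    ≡⟨ cong (λ k → mulMono k R ⊻ mul (map double L) R) (m+ₘm≡double m) ⟩
  mulMono (double m) R ⊻ mul (map double L) R ∎
  where open SetoidReasoning ≋-setoid

section : Bool → Bool → Series → Series
section r s R i j = R (consBit r i) (consBit s j)

section-cong : ∀ r s {R S} → R ≋ S → section r s R ≋ section r s S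
section-cong r s e i j = e (consBit r i) (consBit s j)

section-mulMono-double : ∀ m r s R → section r s (mulMono (double m) R) ≋ mulMono m (section r s R)
section-mulMono-double (suc a , b)     false s R zero    j       = refl
section-mulMono-double (suc a , b)     true  s R zero    j       = refl
section-mulMono-double (suc a , b)     false s R (suc i) j       = section-mulMono-double (a , b) false s R i j
section-mulMono-double (suc a , b)     true  s R (suc i) j       = section-mulMono-double (a , b) true s R i j
section-mulMono-double (zero  , suc b) r false R i       zero    = refl
section-mulMono-double (zero  , suc b) r true  R i       zero    = refl
section-mulMono-double (zero  , suc b) r false R i       (suc j) = section-mulMono-double (zero , b) r false R i j
section-mulMono-double (zero  , suc b) r true  R i       (suc j) = section-mulMono-double (zero , b) r true R i j
section-mulMono-double (zero  , zero)  r s     R i       j       = refl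

section-mul-double : ∀ L r s R → section r s (mul (map double L) R) ≋ mul L (section r s R)
section-mul-double []      r s R = ≋-refl
section-mul-double (m ∷ L) r s R = ⊻-cong (section-mulMono-double m r s R) (section-mul-double L r s R)

section-frobenius : ∀ L r s R → section r s (mul L (mul L R)) ≋ mul L (section r s R)
section-frobenius L r s R = ≋-trans (section-cong r s (frobenius L R)) (section-mul-double L r s R)

-- Division by D

-- The recurrence says that D · Σ Aₙ(y) xⁿ has no terms of x-degree above 15.
D : List Monomial
D = (0 , 0) ∷ (12 , 4) ∷ (14 , 2) ∷ (16 , 16) ∷ []

D·_ : Series → Series
D·_ = mul D

quotient-origin : ∀ G {N} → D· G ≋ N → G 0 0 ≡ N 0 0
quotient-origin G e = trans (sym (xor-identityʳ (G 0 0))) (e 0 0)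

-- If G = N / D then section r s G = section r s (D · N) / D, because D · D = D(x², y²).
quotient-section : ∀ r s G {N} → D· G ≋ N → D· section r s G ≋ section r s (D· N)
quotient-section r s G e =
  ≋-trans (≋-sym (section-frobenius D r s G)) (section-cong r s (mul-cong D e))

quotient-zero : ∀ G → D· G ≋ 0ˢ → ∀ n k → G n k ≡ false
quotient-zero G e n k = go (n + k) G e (m≤m+n n k) (m≤n+m k n)
  where
  go : ∀ f G → D· G ≋ 0ˢ → ∀ {n k} → n ≤ f → k ≤ f → G n k ≡ false
  go zero    G e z≤n z≤n = quotient-origin G e
  go (suc f) G e {n} {k} n≤ k≤ with binary n | binary k
  ... | bits r i | bits s j =
    go f (section r s G) (≋-trans (quotient-section r s G e) (section-cong r s (mul-0ˢ D)))
       (consBit≤suc⇒≤ r n≤) (consBit≤suc⇒≤ s k≤)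

-- Polynomials as lists of monomials

hits : Monomial → Series
hits (a , b) p q = (a ≡ᵇ p) ∧ (b ≡ᵇ q)

⟦_⟧ : List Monomial → Series
⟦ []    ⟧ = 0ˢ
⟦ m ∷ L ⟧ = hits m ⊻ ⟦ L ⟧

⟦++⟧ : ∀ L M → ⟦ L ++ M ⟧ ≋ ⟦ L ⟧ ⊻ ⟦ M ⟧
⟦++⟧ []      M p q = refl
⟦++⟧ (m ∷ L) M p q = trans (cong (hits m p q xor_) (⟦++⟧ L M p q)) (sym (xor-assoc (hits m p q) _ _))

mulMono-hits : ∀ m n → mulMono m (hits n) ≋ hits (m +ₘ n)
mulMono-hits (suc a , b)     n       zero    q       = refl
mulMono-hits (suc a , b)     n       (suc p) q       = mulMono-hits (a , b) n p q
mulMono-hits (zero  , suc b) (i , j) p       zero    = sym (∧-zeroʳ (i ≡ᵇ p))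
mulMono-hits (zero  , suc b) n       p       (suc q) = mulMono-hits (zero , b) n p q
mulMono-hits (zero  , zero)  (i , j) p       q       = refl

mulMono-⟦⟧ : ∀ m L → mulMono m ⟦ L ⟧ ≋ ⟦ map (m +ₘ_) L ⟧
mulMono-⟦⟧ m []      = mulMono-0ˢ m
mulMono-⟦⟧ m (n ∷ L) = ≋-trans (mulMono-⊻ m (hits n) ⟦ L ⟧) (⊻-cong (mulMono-hits m n) (mulMono-⟦⟧ m L))

infixl 7 _⊗_
_⊗_ : List Monomial → List Monomial → List Monomial
L ⊗ M = concatMap (λ m → map (m +ₘ_) M) L

mul-⟦⟧ : ∀ L M → mul L ⟦ M ⟧ ≋ ⟦ L ⊗ M ⟧
mul-⟦⟧ []      M = ≋-refl
mul-⟦⟧ (m ∷ L) M =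
  ≋-trans (⊻-cong (mulMono-⟦⟧ m M) (mul-⟦⟧ L M)) (≋-sym (⟦++⟧ (map (m +ₘ_) M) (L ⊗ M)))

≡ᵇ-consBit : ∀ p r i → (p ≡ᵇ consBit r i) ≡ not (lowBit p xor r) ∧ (⌊ p /2⌋ ≡ᵇ i)
≡ᵇ-consBit zero          false zero    = refl
≡ᵇ-consBit zero          false (suc i) = refl
≡ᵇ-consBit zero          true  i       = refl
≡ᵇ-consBit (suc zero)    false zero    = refl
≡ᵇ-consBit (suc zero)    false (suc i) = refl
≡ᵇ-consBit (suc zero)    true  zero    = refl
≡ᵇ-consBit (suc zero)    true  (suc i) = refl
≡ᵇ-consBit (suc (suc p)) false zero    = sym (∧-zeroʳ (not (lowBit p xor false)))
≡ᵇ-consBit (suc (suc p)) true  zero    = sym (∧-zeroʳ (not (lowBit p xor true)))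
≡ᵇ-consBit (suc (suc p)) false (suc i) = ≡ᵇ-consBit p false i
≡ᵇ-consBit (suc (suc p)) true  (suc i) = ≡ᵇ-consBit p true i

sectionList : Bool → Bool → List Monomial → List Monomial
sectionList r s []            = []
sectionList r s ((p , q) ∷ L) =
  if not (lowBit p xor r) ∧ not (lowBit q xor s)
  then (⌊ p /2⌋ , ⌊ q /2⌋) ∷ sectionList r s L
  else sectionList r s L

section-⟦⟧ : ∀ r s L → section r s ⟦ L ⟧ ≋ ⟦ sectionList r s L ⟧
section-⟦⟧ r s []            i j = refl
section-⟦⟧ r s ((p , q) ∷ L) i j
  rewrite ≡ᵇ-consBit p r i | ≡ᵇ-consBit q s j | section-⟦⟧ r s L i j
  with not (lowBit p xor r) | not (lowBit q xor s)
... | true  | true  = refl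
... | true  | false = cong (_xor ⟦ sectionList r s L ⟧ i j) (∧-zeroʳ (⌊ p /2⌋ ≡ᵇ i))
... | false | _     = refl

_==ₘ_ : Monomial → Monomial → Bool
(a , b) ==ₘ (c , d) = (a ≡ᵇ c) ∧ (b ≡ᵇ d)

_<ₘ_ : Monomial → Monomial → Bool
(a , b) <ₘ (c , d) = (a <ᵇ c) ∨ ((a ≡ᵇ c) ∧ (b <ᵇ d))

==ₘ⇒≡ : ∀ m n → T (m ==ₘ n) → m ≡ n
==ₘ⇒≡ (a , b) (c , d) t with a ≡ᵇ c in e₁ | b ≡ᵇ d in e₂
... | true | true = cong₂ _,_ (≡ᵇ⇒≡ a c (Equivalence.from T-≡ e₁)) (≡ᵇ⇒≡ b d (Equivalence.from T-≡ e₂))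

toggle : Monomial → List Monomial → List Monomial
toggle m []      = m ∷ []
toggle m (n ∷ L) = if m ==ₘ n then L else if m <ₘ n then m ∷ n ∷ L else n ∷ toggle m L

normalize : List Monomial → List Monomial
normalize = foldr toggle []

toggle-⟦⟧ : ∀ m L → ⟦ toggle m L ⟧ ≋ hits m ⊻ ⟦ L ⟧
toggle-⟦⟧ m []      p q = refl
toggle-⟦⟧ m (n ∷ L) p q with m ==ₘ n in e
... | true rewrite ==ₘ⇒≡ m n (Equivalence.from T-≡ e) =
  trans (sym (cong (_xor ⟦ L ⟧ p q) (xor-same (hits n p q)))) (xor-assoc (hits n p q) _ _)
... | false with m <ₘ n
...   | true  = refl
...   | false = trans (cong (hits n p q xor_) (toggle-⟦⟧ m L p q)) (x∙yz≈y∙xz (hits n p q) (hits m p q) (⟦ L ⟧ p q))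

normalize-⟦⟧ : ∀ L → ⟦ normalize L ⟧ ≋ ⟦ L ⟧
normalize-⟦⟧ []      = ≋-refl
normalize-⟦⟧ (m ∷ L) = ≋-trans (toggle-⟦⟧ m (normalize L)) (⊻-cong (≋-refl {hits m}) (normalize-⟦⟧ L))

nextNumerator : Bool → Bool → List Monomial → List Monomial
nextNumerator r s N = normalize (sectionList r s (D ⊗ N))

quotient-step : ∀ r s G N → D· G ≋ ⟦ N ⟧ → D· section r s G ≋ ⟦ nextNumerator r s N ⟧
quotient-step r s G N e = begin
  D· section r s G              ≈⟨ quotient-section r s G e ⟩
  section r s (D· ⟦ N ⟧)        ≈⟨ section-cong r s (mul-⟦⟧ D N) ⟩
  section r s ⟦ D ⊗ N ⟧         ≈⟨ section-⟦⟧ r s (D ⊗ N) ⟩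
  ⟦ sectionList r s (D ⊗ N) ⟧   ≈⟨ ≋-sym (normalize-⟦⟧ (sectionList r s (D ⊗ N))) ⟩
  ⟦ nextNumerator r s N ⟧       ∎
  where open SetoidReasoning ≋-setoid

-- The exponent [a,b] and bit interleaving

gAux-zero : ∀ f → gAux f 0 ≡ 0
gAux-zero zero    = refl
gAux-zero (suc f) = cong (λ x → 4 * x + 0) (gAux-zero f)

n/2≡⌊n/2⌋ : ∀ n → n / 2 ≡ ⌊ n /2⌋
n/2≡⌊n/2⌋ zero          = refl
n/2≡⌊n/2⌋ (suc zero)    = refl
n/2≡⌊n/2⌋ (suc (suc n)) = trans (divₕ-extractAcc 1 1 n 1) (cong suc (n/2≡⌊n/2⌋ n))

n%2≡lowBit : ∀ n → n % 2 ≡ b2n (lowBit n)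
n%2≡lowBit zero          = refl
n%2≡lowBit (suc zero)    = refl
n%2≡lowBit (suc (suc n)) = n%2≡lowBit n

gAux-fuel : ∀ f f′ {n} → n ≤ f → n ≤ f′ → gAux f n ≡ gAux f′ n
gAux-fuel zero    zero     _   _   = refl
gAux-fuel zero    (suc f′) z≤n _   = sym (gAux-zero (suc f′))
gAux-fuel (suc f) zero     _   z≤n = gAux-zero (suc f)
gAux-fuel (suc f) (suc f′) {n} n≤f n≤f′ rewrite n/2≡⌊n/2⌋ n =
  cong (λ x → 4 * x + n % 2) (gAux-fuel f f′ (≤suc⇒⌊/2⌋≤ n≤f) (≤suc⇒⌊/2⌋≤ n≤f′))

g-unfold : ∀ n → g n ≡ b2n (lowBit n) + 4 * g ⌊ n /2⌋
g-unfold zero    = refl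
g-unfold (suc f) = begin
  4 * gAux f (suc f / 2) + suc f % 2
    ≡⟨ cong₂ (λ x y → 4 * gAux f x + y) (n/2≡⌊n/2⌋ (suc f)) (n%2≡lowBit (suc f)) ⟩
  4 * gAux f ⌊ suc f /2⌋ + b2n (lowBit (suc f))
    ≡⟨ cong (λ x → 4 * x + b2n (lowBit (suc f))) (gAux-fuel f ⌊ suc f /2⌋ (≤suc⇒⌊/2⌋≤ ≤-refl) ≤-refl) ⟩
  4 * g ⌊ suc f /2⌋ + b2n (lowBit (suc f))
    ≡⟨ +-comm _ (b2n (lowBit (suc f))) ⟩
  b2n (lowBit (suc f)) + 4 * g ⌊ suc f /2⌋ ∎
  where open ≡-Reasoning

g-consBit : ∀ r n → g (consBit r n) ≡ b2n r + 4 * g n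
g-consBit r n = trans (g-unfold (consBit r n)) (cong₂ (λ x y → b2n x + 4 * g y) (lowBit-consBit r n) (⌊consBit/2⌋ r n))

interleave : ℕ → ℕ → ℕ
interleave a b = g a + 2 * g b

interleave-consBit : ∀ α β a b → interleave (consBit α a) (consBit β b) ≡ consBit α (consBit β (interleave a b))
interleave-consBit α β a b = begin
  g (consBit α a) + 2 * g (consBit β b)             ≡⟨ cong₂ (λ x y → x + 2 * y) (g-consBit α a) (g-consBit β b) ⟩
  b2n α + 4 * g a + 2 * (b2n β + 4 * g b)           ≡⟨ regroup (b2n α) (b2n β) (g a) (g b) ⟩
  b2n α + 2 * (b2n β + 2 * interleave a b)          ≡⟨ cong (λ x → b2n α + 2 * x) (sym (consBit≡ β (interleave a b))) ⟩
  b2n α + 2 * consBit β (interleave a b)            ≡⟨ sym (consBit≡ α _) ⟩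
  consBit α (consBit β (interleave a b))            ∎
  where
  open ≡-Reasoning
  regroup : ∀ x y u v → x + 4 * u + 2 * (y + 4 * v) ≡ x + 2 * (y + 2 * (u + 2 * v))
  regroup = solve-∀

br≡consBit-interleave : ∀ a b → br a b ≡ consBit true (interleave a b)
br≡consBit-interleave a b = cong suc (trans (regroup (g a) (g b)) (sym (consBit≡ false (interleave a b))))
  where
  regroup : ∀ u v → 2 * u + 4 * v ≡ 2 * (u + 2 * v)
  regroup = solve-∀

interleave-surjective : ∀ n → ∃[ c ] ∃[ d ] interleave c d ≡ n
interleave-surjective n = go n ≤-refl
  where
  go : ∀ f {n} → n ≤ f → ∃[ c ] ∃[ d ] interleave c d ≡ n
  go zero    z≤n = 0 , 0 , refl
  go (suc f) {n} n≤ with binary n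
  ... | bits α m with binary m
  ...   | bits β k with go f (≤-trans (n≤consBit β k) (consBit≤suc⇒≤ α n≤))
  ...     | c , d , refl = consBit α c , consBit β d , interleave-consBit α β c d

-- Comparing the exponents digit by digit

Offsets : Set
Offsets = ℕ × ℕ × Maybe (ℕ × ℕ)

-- Lexicographic comparison of (c + d, d) with (a + b, b), shifted by offsets that carry the
-- contribution of lower digits; without a second offset only the sums are compared.
Within : Offsets → ℕ → ℕ → ℕ → ℕ → Set
Within (δc , δa , nothing)        a b c d = c + d + δc ≤ a + b + δa
Within (δc , δa , just (εd , εb)) a b c d =
  c + d + δc < a + b + δa ⊎ (c + d + δc ≡ a + b + δa × d + εd ≤ b + εb)

stepCondition : Offsets → Offsets → Bool → Bool → Bool → Bool → Bool
stepCondition (δc , δa , nothing) (δc′ , δa′ , nothing) α β γ η =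
  b2n γ + b2n η + δc + 2 * δa′ ≤ᵇ b2n α + b2n β + δa + 2 * δc′
stepCondition (δc , δa , nothing) (_ , _ , just _) α β γ η = false
stepCondition (δc , δa , just _) (δc′ , δa′ , nothing) α β γ η =
  suc (b2n γ + b2n η + δc) + 2 * δa′ ≤ᵇ b2n α + b2n β + δa + 2 * δc′
stepCondition (δc , δa , just (εd , εb)) (δc′ , δa′ , just (εd′ , εb′)) α β γ η =
  (b2n γ + b2n η + δc + 2 * δa′ ≡ᵇ b2n α + b2n β + δa + 2 * δc′)
  ∧ (b2n η + εd + 2 * εb′ ≤ᵇ b2n β + εb + 2 * εd′)

digit+ : ∀ r x δ → consBit r x + δ ≡ 2 * x + (b2n r + δ)
digit+ r x δ = trans (cong (_+ δ) (consBit≡ r x)) (regroup (b2n r) x δ)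
  where
  regroup : ∀ u x δ → u + 2 * x + δ ≡ 2 * x + (u + δ)
  regroup = solve-∀

digits+ : ∀ r s x y δ → consBit r x + consBit s y + δ ≡ 2 * (x + y) + (b2n r + b2n s + δ)
digits+ r s x y δ = trans (cong₂ (λ u v → u + v + δ) (consBit≡ r x) (consBit≡ s y)) (regroup (b2n r) (b2n s) x y δ)
  where
  regroup : ∀ u v x y δ → u + 2 * x + (v + 2 * y) + δ ≡ 2 * (x + y) + (u + v + δ)
  regroup = solve-∀

double-≤ : ∀ X Y L M x y → X + x ≤ Y + y → L + 2 * y ≤ M + 2 * x → 2 * X + L ≤ 2 * Y + M
double-≤ X Y L M x y le₁ le₂ = +-cancelʳ-≤ (2 * y) (2 * X + L) (2 * Y + M) (begin
  2 * X + L + 2 * y     ≡⟨ +-assoc (2 * X) L (2 * y) ⟩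
  2 * X + (L + 2 * y)   ≤⟨ +-monoʳ-≤ (2 * X) le₂ ⟩
  2 * X + (M + 2 * x)   ≡⟨ regroup X M x ⟩
  M + 2 * (X + x)       ≤⟨ +-monoʳ-≤ M (*-monoʳ-≤ 2 le₁) ⟩
  M + 2 * (Y + y)       ≡⟨ sym (regroup Y M y) ⟩
  2 * Y + (M + 2 * y)   ≡⟨ sym (+-assoc (2 * Y) M (2 * y)) ⟩
  2 * Y + M + 2 * y     ∎)
  where
  open ≤-Reasoning
  regroup : ∀ X M x → 2 * X + (M + 2 * x) ≡ M + 2 * (X + x)
  regroup = solve-∀

double-≡ : ∀ X Y L M x y → X + x ≡ Y + y → L + 2 * y ≡ M + 2 * x → 2 * X + L ≡ 2 * Y + M
double-≡ X Y L M x y eq₁ eq₂ =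
  ≤-antisym (double-≤ X Y L M x y (≤-reflexive eq₁) (≤-reflexive eq₂))
            (double-≤ Y X M L y x (≤-reflexive (sym eq₁)) (≤-reflexive (sym eq₂)))

within-step : ∀ o o′ α β γ η {a b c d} → T (stepCondition o o′ α β γ η) →
  Within o′ a b c d → Within o (consBit α a) (consBit β b) (consBit γ c) (consBit η d)
within-step (δc , δa , nothing) (δc′ , δa′ , nothing) α β γ η {a} {b} {c} {d} t w
  rewrite digits+ γ η c d δc | digits+ α β a b δa =
  double-≤ (c + d) (a + b) (b2n γ + b2n η + δc) (b2n α + b2n β + δa) δc′ δa′ w (≤ᵇ⇒≤ _ _ t)
within-step (δc , δa , just _) (δc′ , δa′ , nothing) α β γ η {a} {b} {c} {d} t w
  rewrite digits+ γ η c d δc | digits+ α β a b δa =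
  inj₁ (subst (_≤ 2 * (a + b) + (b2n α + b2n β + δa)) (+-suc (2 * (c + d)) _)
    (double-≤ (c + d) (a + b) (suc (b2n γ + b2n η + δc)) (b2n α + b2n β + δa) δc′ δa′ w (≤ᵇ⇒≤ _ _ t)))
within-step (δc , δa , just _) (δc′ , δa′ , just _) α β γ η {a} {b} {c} {d} t (inj₁ lt)
  rewrite digits+ γ η c d δc | digits+ α β a b δa =
  inj₁ (≤-trans (n≤1+n _) (subst (_≤ 2 * (a + b) + (b2n α + b2n β + δa)) (twice-suc (c + d) _)
    (double-≤ (suc (c + d)) (a + b) (b2n γ + b2n η + δc) (b2n α + b2n β + δa) δc′ δa′ lt
              (≤-reflexive (≡ᵇ⇒≡ _ _ (T-∧ˡ t))))))
  where
  twice-suc : ∀ n L → 2 * suc n + L ≡ suc (suc (2 * n + L))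
  twice-suc = solve-∀
within-step (δc , δa , just (εd , εb)) (δc′ , δa′ , just (εd′ , εb′)) α β γ η {a} {b} {c} {d} t (inj₂ (eq , le))
  rewrite digits+ γ η c d δc | digits+ α β a b δa | digit+ η d εd | digit+ β b εb =
  inj₂ ( double-≡ (c + d) (a + b) (b2n γ + b2n η + δc) (b2n α + b2n β + δa) δc′ δa′ eq (≡ᵇ⇒≡ _ _ (T-∧ˡ t))
       , double-≤ d b (b2n η + εd) (b2n β + εb) εd′ εb′ le (≤ᵇ⇒≤ _ _ (T-∧ʳ t)))

withinAtOrigin : Offsets → Bool
withinAtOrigin (δc , δa , nothing)        = δc ≤ᵇ δa
withinAtOrigin (δc , δa , just (εd , εb)) = (δc <ᵇ δa) ∨ ((δc ≡ᵇ δa) ∧ (εd ≤ᵇ εb))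

withinAtOrigin-sound : ∀ o → T (withinAtOrigin o) → Within o 0 0 0 0
withinAtOrigin-sound (δc , δa , nothing)        t = ≤ᵇ⇒≤ δc δa t
withinAtOrigin-sound (δc , δa , just (εd , εb)) t with δc <ᵇ δa in lt
... | true  = inj₁ (<ᵇ⇒< δc δa (Equivalence.from T-≡ lt))
... | false = inj₂ (≡ᵇ⇒≡ δc δa (T-∧ˡ t) , ≤ᵇ⇒≤ εd εb (T-∧ʳ t))

-- Finite automata

byBits : {A : Set} → A → A → A → A → Bool → Bool → A
byBits x₀₀ x₀₁ x₁₀ x₁₁ false false = x₀₀
byBits x₀₀ x₀₁ x₁₀ x₁₁ false true  = x₀₁
byBits x₀₀ x₀₁ x₁₀ x₁₁ true  false = x₁₀
byBits x₀₀ x₀₁ x₁₀ x₁₁ true  true  = x₁₁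

∀ᵇ : (Bool → Bool) → Bool
∀ᵇ f = f false ∧ f true

∀ᵇ-sound : ∀ f → T (∀ᵇ f) → ∀ b → T (f b)
∀ᵇ-sound f t false = T-∧ˡ t
∀ᵇ-sound f t true  = T-∧ʳ t

∀ᵇ² : (Bool → Bool → Bool) → Bool
∀ᵇ² f = ∀ᵇ λ r → ∀ᵇ (f r)

∀ᵇ²-sound : ∀ f → T (∀ᵇ² f) → ∀ r s → T (f r s)
∀ᵇ²-sound f t r = ∀ᵇ-sound (f r) (∀ᵇ-sound (λ r → ∀ᵇ (f r)) t r)

∀ᵇ⁴ : (Bool → Bool → Bool → Bool → Bool) → Bool
∀ᵇ⁴ f = ∀ᵇ² λ α β → ∀ᵇ² (f α β)

∀ᵇ⁴-sound : ∀ f → T (∀ᵇ⁴ f) → ∀ α β γ η → T (f α β γ η)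
∀ᵇ⁴-sound f t α β = ∀ᵇ²-sound (f α β) (∀ᵇ²-sound (λ α β → ∀ᵇ² (f α β)) t α β)

data Bound : Set where
  q0 q1 q2 q3 q4 q5 q6 q7 q8 : Bound

-- Within (offsets q0) a b c d says that [c,d] is [a - 1, b] or precedes it.
offsets : Bound → Offsets
offsets q0 = 1 , 0 , just (0 , 0)
offsets q1 = 0 , 0 , just (0 , 0)
offsets q2 = 0 , 0 , just (1 , 0)
offsets q3 = 0 , 0 , nothing
offsets q4 = 0 , 1 , just (0 , 0)
offsets q5 = 0 , 1 , nothing
offsets q6 = 1 , 0 , just (1 , 0)
offsets q7 = 1 , 0 , nothing
offsets q8 = 2 , 0 , nothing

∀q : (Bound → Bool) → Bool
∀q f = f q0 ∧ f q1 ∧ f q2 ∧ f q3 ∧ f q4 ∧ f q5 ∧ f q6 ∧ f q7 ∧ f q8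

∀q-sound : ∀ f → T (∀q f) → ∀ p → T (f p)
∀q-sound f t q0 = T-∧ˡ t
∀q-sound f t q1 = T-∧ˡ (T-∧ʳ {f q0} t)
∀q-sound f t q2 = T-∧ˡ (T-∧ʳ {f q1} (T-∧ʳ {f q0} t))
∀q-sound f t q3 = T-∧ˡ (T-∧ʳ {f q2} (T-∧ʳ {f q1} (T-∧ʳ {f q0} t)))
∀q-sound f t q4 = T-∧ˡ (T-∧ʳ {f q3} (T-∧ʳ {f q2} (T-∧ʳ {f q1} (T-∧ʳ {f q0} t))))
∀q-sound f t q5 = T-∧ˡ (T-∧ʳ {f q4} (T-∧ʳ {f q3} (T-∧ʳ {f q2} (T-∧ʳ {f q1} (T-∧ʳ {f q0} t)))))
∀q-sound f t q6 = T-∧ˡ (T-∧ʳ {f q5} (T-∧ʳ {f q4} (T-∧ʳ {f q3} (T-∧ʳ {f q2} (T-∧ʳ {f q1} (T-∧ʳ {f q0} t))))))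
∀q-sound f t q7 = T-∧ˡ (T-∧ʳ {f q6} (T-∧ʳ {f q5} (T-∧ʳ {f q4}
  (T-∧ʳ {f q3} (T-∧ʳ {f q2} (T-∧ʳ {f q1} (T-∧ʳ {f q0} t)))))))
∀q-sound f t q8 = T-∧ʳ {f q7} (T-∧ʳ {f q6} (T-∧ʳ {f q5} (T-∧ʳ {f q4}
  (T-∧ʳ {f q3} (T-∧ʳ {f q2} (T-∧ʳ {f q1} (T-∧ʳ {f q0} t)))))))

boundIndex : Bound → ℕ
boundIndex q0 = 0
boundIndex q1 = 1
boundIndex q2 = 2
boundIndex q3 = 3
boundIndex q4 = 4
boundIndex q5 = 5
boundIndex q6 = 6
boundIndex q7 = 7
boundIndex q8 = 8

among : List Bound → Bound → Bool
among ps p = any (λ q → boundIndex q ≡ᵇ boundIndex p) ps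

nextBound : Bound → Bool → Bool → Bool → Bool → Bound
nextBound q0 = byBits (byBits q7 q6 q0 q8) (byBits q1 q7 q7 q0) (byBits q1 q7 q7 q6) (byBits q3 q1 q1 q7)
nextBound q1 = byBits (byBits q1 q7 q7 q6) (byBits q3 q1 q1 q7) (byBits q3 q2 q1 q7) (byBits q4 q3 q3 q1)
nextBound q2 = byBits (byBits q2 q7 q7 q6) (byBits q3 q2 q1 q7) (byBits q3 q2 q2 q7) (byBits q4 q3 q3 q2)
nextBound q3 = byBits (byBits q3 q7 q7 q7) (byBits q3 q3 q3 q7) (byBits q3 q3 q3 q7) (byBits q5 q3 q3 q3)
nextBound q4 = byBits (byBits q3 q2 q1 q7) (byBits q4 q3 q3 q1) (byBits q4 q3 q3 q2) (byBits q5 q4 q4 q3)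
nextBound q5 = byBits (byBits q3 q3 q3 q7) (byBits q5 q3 q3 q3) (byBits q5 q3 q3 q3) (byBits q5 q5 q5 q3)
nextBound q6 = byBits (byBits q7 q6 q6 q8) (byBits q1 q7 q7 q6) (byBits q2 q7 q7 q6) (byBits q3 q2 q1 q7)
nextBound q7 = byBits (byBits q7 q7 q7 q8) (byBits q3 q7 q7 q7) (byBits q3 q7 q7 q7) (byBits q3 q3 q3 q7)
nextBound q8 = byBits (byBits q7 q8 q8 q8) (byBits q7 q7 q7 q8) (byBits q7 q7 q7 q8) (byBits q3 q7 q7 q7)

boundTransitionValid : Bound → Bool → Bool → Bool → Bool → Bool
boundTransitionValid p α β γ η = stepCondition (offsets p) (offsets (nextBound p α β γ η)) α β γ η

nextBound-sound : ∀ p α β γ η → T (stepCondition (offsets p) (offsets (nextBound p α β γ η)) α β γ η)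
nextBound-sound p = ∀ᵇ⁴-sound (boundTransitionValid p) (∀q-sound (λ p → ∀ᵇ⁴ (boundTransitionValid p)) tt p)

-- The numerators reachable from initialNumerator; `consistent` checks that next computes
-- nextNumerator on them.
data State : Set where
  s0 s1 s2 s3 s4 s5 s6 s7 s8 s9 s10 s11 s12 s13 s14 s15 s16 s17 s18 s19 s20 s21 s22 : State
  s23 s24 s25 s26 s27 s28 s29 s30 s31 s32 s33 s34 s35 s36 s37 s38 s39 s40 s41 s42 s43 s44 s45 : State
  s46 s47 s48 s49 s50 s51 s52 s53 s54 s55 s56 s57 s58 s59 s60 s61 s62 s63 s64 s65 s66 s67 s68 : State

numerator : State → List Monomial
numerator s0 = (1 , 0) ∷ (3 , 2) ∷ (4 , 1) ∷ (5 , 0) ∷ (5 , 4) ∷ (6 , 3) ∷ (7 , 2) ∷ (7 , 6) ∷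
  (8 , 1) ∷ (9 , 4) ∷ (9 , 8) ∷ (11 , 6) ∷ (11 , 10) ∷ (12 , 1) ∷ (12 , 9) ∷ (13 , 4) ∷ (13 , 12) ∷
  (14 , 7) ∷ (14 , 11) ∷ (15 , 14) ∷ []
numerator s1 = []
numerator s2 = (2 , 0) ∷ (3 , 1) ∷ (4 , 0) ∷ (6 , 0) ∷ (6 , 4) ∷ (7 , 3) ∷ (7 , 5) ∷ (8 , 2) ∷
  (9 , 1) ∷ (9 , 3) ∷ (10 , 8) ∷ (11 , 1) ∷ (11 , 9) ∷ (12 , 2) ∷ (12 , 6) ∷ (12 , 8) ∷ (13 , 1) ∷
  (13 , 7) ∷ (14 , 4) ∷ (14 , 6) ∷ (14 , 8) ∷ (14 , 12) ∷ (15 , 11) ∷ (15 , 13) ∷ []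
numerator s3 = (0 , 0) ∷ (1 , 1) ∷ (2 , 0) ∷ (2 , 2) ∷ (3 , 1) ∷ (3 , 3) ∷ (4 , 2) ∷ (4 , 4) ∷
  (5 , 3) ∷ (5 , 5) ∷ (6 , 6) ∷ (7 , 1) ∷ (7 , 3) ∷ (7 , 7) ∷ (8 , 4) ∷ (8 , 8) ∷ (9 , 1) ∷
  (9 , 5) ∷ (9 , 9) ∷ (10 , 2) ∷ (10 , 6) ∷ (10 , 8) ∷ (10 , 10) ∷ (11 , 3) ∷ (11 , 7) ∷ (11 , 9) ∷
  (11 , 11) ∷ (12 , 6) ∷ (12 , 8) ∷ (12 , 10) ∷ (12 , 12) ∷ (13 , 3) ∷ (13 , 7) ∷ (13 , 9) ∷
  (13 , 11) ∷ (13 , 13) ∷ (14 , 8) ∷ (14 , 10) ∷ (14 , 14) ∷ (15 , 15) ∷ []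
numerator s4 = (1 , 0) ∷ (2 , 0) ∷ (3 , 0) ∷ (3 , 2) ∷ (4 , 1) ∷ (5 , 4) ∷ (6 , 1) ∷ (6 , 3) ∷
  (6 , 4) ∷ (7 , 3) ∷ (7 , 4) ∷ (7 , 6) ∷ (8 , 1) ∷ (8 , 2) ∷ (9 , 1) ∷ (9 , 2) ∷ (9 , 4) ∷
  (9 , 8) ∷ (10 , 1) ∷ (10 , 8) ∷ (11 , 2) ∷ (11 , 6) ∷ (11 , 8) ∷ (11 , 10) ∷ (12 , 3) ∷ (12 , 6) ∷
  (12 , 9) ∷ (13 , 2) ∷ (13 , 6) ∷ (13 , 8) ∷ (13 , 12) ∷ (14 , 3) ∷ (14 , 4) ∷ (14 , 5) ∷
  (14 , 7) ∷ (14 , 9) ∷ (14 , 11) ∷ (14 , 12) ∷ (15 , 10) ∷ (15 , 11) ∷ (15 , 12) ∷ (15 , 14) ∷ []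
numerator s5 = (1 , 0) ∷ (3 , 1) ∷ (3 , 2) ∷ (4 , 0) ∷ (4 , 1) ∷ (5 , 0) ∷ (5 , 4) ∷ (6 , 0) ∷
  (6 , 3) ∷ (7 , 2) ∷ (7 , 5) ∷ (7 , 6) ∷ (8 , 1) ∷ (9 , 3) ∷ (9 , 4) ∷ (9 , 8) ∷ (11 , 1) ∷
  (11 , 6) ∷ (11 , 9) ∷ (11 , 10) ∷ (12 , 1) ∷ (12 , 2) ∷ (12 , 8) ∷ (12 , 9) ∷ (13 , 1) ∷
  (13 , 4) ∷ (13 , 7) ∷ (13 , 12) ∷ (14 , 6) ∷ (14 , 7) ∷ (14 , 8) ∷ (14 , 11) ∷ (15 , 13) ∷
  (15 , 14) ∷ []
numerator s6 = (0 , 0) ∷ (1 , 0) ∷ (1 , 1) ∷ (2 , 1) ∷ (2 , 2) ∷ (3 , 3) ∷ (4 , 2) ∷ (4 , 4) ∷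
  (5 , 1) ∷ (5 , 3) ∷ (5 , 4) ∷ (5 , 5) ∷ (6 , 2) ∷ (6 , 3) ∷ (6 , 4) ∷ (6 , 5) ∷ (6 , 6) ∷
  (7 , 1) ∷ (7 , 2) ∷ (7 , 3) ∷ (7 , 4) ∷ (7 , 5) ∷ (7 , 7) ∷ (8 , 1) ∷ (8 , 2) ∷ (8 , 3) ∷
  (8 , 4) ∷ (8 , 8) ∷ (9 , 2) ∷ (9 , 3) ∷ (9 , 5) ∷ (9 , 8) ∷ (9 , 9) ∷ (10 , 6) ∷ (10 , 9) ∷
  (10 , 10) ∷ (11 , 6) ∷ (11 , 7) ∷ (11 , 11) ∷ (12 , 2) ∷ (12 , 4) ∷ (12 , 7) ∷ (12 , 8) ∷
  (12 , 10) ∷ (12 , 12) ∷ (13 , 4) ∷ (13 , 5) ∷ (13 , 11) ∷ (13 , 12) ∷ (13 , 13) ∷ (14 , 5) ∷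
  (14 , 6) ∷ (14 , 8) ∷ (14 , 11) ∷ (14 , 12) ∷ (14 , 13) ∷ (14 , 14) ∷ (15 , 12) ∷ (15 , 13) ∷
  (15 , 15) ∷ []
numerator s7 = (0 , 0) ∷ (1 , 0) ∷ (1 , 1) ∷ (2 , 1) ∷ (2 , 2) ∷ (3 , 0) ∷ (3 , 1) ∷ (3 , 3) ∷
  (4 , 0) ∷ (4 , 2) ∷ (4 , 4) ∷ (5 , 1) ∷ (5 , 3) ∷ (5 , 4) ∷ (5 , 5) ∷ (6 , 1) ∷ (6 , 2) ∷
  (6 , 3) ∷ (6 , 4) ∷ (6 , 5) ∷ (6 , 6) ∷ (7 , 1) ∷ (7 , 2) ∷ (7 , 3) ∷ (7 , 7) ∷ (8 , 1) ∷
  (8 , 2) ∷ (8 , 3) ∷ (8 , 4) ∷ (8 , 8) ∷ (9 , 5) ∷ (9 , 8) ∷ (9 , 9) ∷ (10 , 1) ∷ (10 , 6) ∷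
  (10 , 9) ∷ (10 , 10) ∷ (11 , 1) ∷ (11 , 6) ∷ (11 , 7) ∷ (11 , 8) ∷ (11 , 9) ∷ (11 , 11) ∷
  (12 , 2) ∷ (12 , 3) ∷ (12 , 4) ∷ (12 , 7) ∷ (12 , 10) ∷ (12 , 12) ∷ (13 , 2) ∷ (13 , 4) ∷
  (13 , 5) ∷ (13 , 6) ∷ (13 , 7) ∷ (13 , 11) ∷ (13 , 12) ∷ (13 , 13) ∷ (14 , 8) ∷ (14 , 9) ∷
  (14 , 11) ∷ (14 , 12) ∷ (14 , 13) ∷ (14 , 14) ∷ (15 , 15) ∷ []
numerator s8 = (1 , 0) ∷ (3 , 2) ∷ (4 , 1) ∷ (5 , 4) ∷ (6 , 3) ∷ (7 , 6) ∷ (8 , 1) ∷ (9 , 4) ∷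
  (9 , 8) ∷ (11 , 2) ∷ (11 , 6) ∷ (11 , 10) ∷ (12 , 9) ∷ (13 , 8) ∷ (13 , 12) ∷ (14 , 3) ∷
  (14 , 7) ∷ (14 , 11) ∷ (15 , 10) ∷ (15 , 14) ∷ []
numerator s9 = (2 , 0) ∷ (3 , 0) ∷ (3 , 1) ∷ (4 , 0) ∷ (5 , 0) ∷ (6 , 1) ∷ (6 , 4) ∷ (7 , 1) ∷
  (7 , 2) ∷ (7 , 3) ∷ (7 , 4) ∷ (7 , 5) ∷ (8 , 2) ∷ (9 , 1) ∷ (9 , 2) ∷ (9 , 3) ∷ (10 , 1) ∷
  (10 , 8) ∷ (11 , 1) ∷ (11 , 2) ∷ (11 , 8) ∷ (11 , 9) ∷ (12 , 1) ∷ (12 , 3) ∷ (12 , 6) ∷ (12 , 8) ∷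
  (13 , 2) ∷ (13 , 3) ∷ (13 , 4) ∷ (13 , 6) ∷ (13 , 7) ∷ (13 , 8) ∷ (14 , 2) ∷ (14 , 3) ∷ (14 , 4) ∷
  (14 , 5) ∷ (14 , 6) ∷ (14 , 9) ∷ (14 , 12) ∷ (15 , 9) ∷ (15 , 10) ∷ (15 , 11) ∷ (15 , 12) ∷
  (15 , 13) ∷ []
numerator s10 = (0 , 0) ∷ (1 , 0) ∷ (1 , 1) ∷ (2 , 2) ∷ (3 , 2) ∷ (3 , 3) ∷ (4 , 1) ∷ (4 , 2) ∷
  (4 , 4) ∷ (5 , 1) ∷ (5 , 3) ∷ (5 , 4) ∷ (5 , 5) ∷ (6 , 1) ∷ (6 , 2) ∷ (6 , 3) ∷ (6 , 4) ∷
  (6 , 6) ∷ (7 , 1) ∷ (7 , 2) ∷ (7 , 3) ∷ (7 , 5) ∷ (7 , 6) ∷ (7 , 7) ∷ (8 , 1) ∷ (8 , 2) ∷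
  (8 , 4) ∷ (8 , 8) ∷ (9 , 3) ∷ (9 , 4) ∷ (9 , 5) ∷ (9 , 8) ∷ (9 , 9) ∷ (10 , 6) ∷ (10 , 10) ∷
  (11 , 2) ∷ (11 , 6) ∷ (11 , 7) ∷ (11 , 10) ∷ (11 , 11) ∷ (12 , 2) ∷ (12 , 3) ∷ (12 , 4) ∷
  (12 , 8) ∷ (12 , 9) ∷ (12 , 10) ∷ (12 , 12) ∷ (13 , 2) ∷ (13 , 4) ∷ (13 , 5) ∷ (13 , 8) ∷
  (13 , 11) ∷ (13 , 12) ∷ (13 , 13) ∷ (14 , 6) ∷ (14 , 7) ∷ (14 , 8) ∷ (14 , 9) ∷ (14 , 11) ∷
  (14 , 12) ∷ (14 , 14) ∷ (15 , 13) ∷ (15 , 14) ∷ (15 , 15) ∷ []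
numerator s11 = (3 , 1) ∷ (4 , 0) ∷ (7 , 5) ∷ (9 , 3) ∷ (11 , 1) ∷ (11 , 9) ∷ (12 , 8) ∷ (13 , 7) ∷
  (14 , 6) ∷ (15 , 13) ∷ []
numerator s12 = (2 , 0) ∷ (3 , 0) ∷ (6 , 1) ∷ (6 , 4) ∷ (7 , 3) ∷ (7 , 4) ∷ (8 , 2) ∷ (9 , 1) ∷
  (9 , 2) ∷ (10 , 1) ∷ (10 , 8) ∷ (11 , 8) ∷ (12 , 3) ∷ (12 , 6) ∷ (13 , 2) ∷ (13 , 6) ∷ (14 , 4) ∷
  (14 , 5) ∷ (14 , 9) ∷ (14 , 12) ∷ (15 , 11) ∷ (15 , 12) ∷ []
numerator s13 = (1 , 0) ∷ (3 , 2) ∷ (4 , 1) ∷ (5 , 0) ∷ (5 , 4) ∷ (6 , 0) ∷ (6 , 3) ∷ (7 , 2) ∷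
  (7 , 6) ∷ (8 , 1) ∷ (9 , 4) ∷ (9 , 8) ∷ (11 , 6) ∷ (11 , 10) ∷ (12 , 1) ∷ (12 , 2) ∷ (12 , 9) ∷
  (13 , 1) ∷ (13 , 4) ∷ (13 , 12) ∷ (14 , 7) ∷ (14 , 8) ∷ (14 , 11) ∷ (15 , 14) ∷ []
numerator s14 = (0 , 0) ∷ (1 , 1) ∷ (2 , 1) ∷ (2 , 2) ∷ (3 , 1) ∷ (3 , 2) ∷ (3 , 3) ∷ (4 , 1) ∷
  (4 , 2) ∷ (4 , 4) ∷ (5 , 3) ∷ (5 , 5) ∷ (6 , 1) ∷ (6 , 4) ∷ (6 , 5) ∷ (6 , 6) ∷ (7 , 1) ∷
  (7 , 4) ∷ (7 , 6) ∷ (7 , 7) ∷ (8 , 2) ∷ (8 , 3) ∷ (8 , 4) ∷ (8 , 8) ∷ (9 , 2) ∷ (9 , 4) ∷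
  (9 , 5) ∷ (9 , 9) ∷ (10 , 2) ∷ (10 , 6) ∷ (10 , 9) ∷ (10 , 10) ∷ (11 , 2) ∷ (11 , 3) ∷ (11 , 7) ∷
  (11 , 9) ∷ (11 , 10) ∷ (11 , 11) ∷ (12 , 3) ∷ (12 , 7) ∷ (12 , 8) ∷ (12 , 9) ∷ (12 , 10) ∷
  (12 , 12) ∷ (13 , 2) ∷ (13 , 3) ∷ (13 , 7) ∷ (13 , 8) ∷ (13 , 9) ∷ (13 , 11) ∷ (13 , 13) ∷
  (14 , 4) ∷ (14 , 5) ∷ (14 , 7) ∷ (14 , 8) ∷ (14 , 9) ∷ (14 , 10) ∷ (14 , 12) ∷ (14 , 13) ∷
  (14 , 14) ∷ (15 , 11) ∷ (15 , 12) ∷ (15 , 14) ∷ (15 , 15) ∷ []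
numerator s15 = (1 , 0) ∷ (3 , 1) ∷ (3 , 2) ∷ (4 , 0) ∷ (4 , 1) ∷ (5 , 4) ∷ (6 , 3) ∷ (7 , 5) ∷
  (7 , 6) ∷ (8 , 1) ∷ (9 , 3) ∷ (9 , 4) ∷ (9 , 8) ∷ (11 , 1) ∷ (11 , 2) ∷ (11 , 6) ∷ (11 , 9) ∷
  (11 , 10) ∷ (12 , 8) ∷ (12 , 9) ∷ (13 , 7) ∷ (13 , 8) ∷ (13 , 12) ∷ (14 , 3) ∷ (14 , 6) ∷
  (14 , 7) ∷ (14 , 11) ∷ (15 , 10) ∷ (15 , 13) ∷ (15 , 14) ∷ []
numerator s16 = (0 , 0) ∷ (2 , 2) ∷ (3 , 1) ∷ (3 , 2) ∷ (4 , 1) ∷ (4 , 4) ∷ (5 , 3) ∷ (6 , 6) ∷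
  (7 , 1) ∷ (7 , 6) ∷ (8 , 4) ∷ (8 , 8) ∷ (9 , 4) ∷ (10 , 2) ∷ (10 , 6) ∷ (10 , 10) ∷ (11 , 2) ∷
  (11 , 9) ∷ (11 , 10) ∷ (12 , 8) ∷ (12 , 9) ∷ (12 , 12) ∷ (13 , 3) ∷ (13 , 7) ∷ (13 , 8) ∷
  (13 , 11) ∷ (14 , 7) ∷ (14 , 10) ∷ (14 , 14) ∷ (15 , 14) ∷ []
numerator s17 = (0 , 0) ∷ (1 , 1) ∷ (2 , 0) ∷ (2 , 1) ∷ (2 , 2) ∷ (3 , 0) ∷ (3 , 1) ∷ (3 , 2) ∷
  (3 , 3) ∷ (4 , 1) ∷ (4 , 2) ∷ (4 , 4) ∷ (5 , 3) ∷ (5 , 5) ∷ (6 , 5) ∷ (6 , 6) ∷ (7 , 1) ∷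
  (7 , 3) ∷ (7 , 6) ∷ (7 , 7) ∷ (8 , 3) ∷ (8 , 4) ∷ (8 , 8) ∷ (9 , 1) ∷ (9 , 4) ∷ (9 , 5) ∷
  (9 , 9) ∷ (10 , 1) ∷ (10 , 2) ∷ (10 , 6) ∷ (10 , 8) ∷ (10 , 9) ∷ (10 , 10) ∷ (11 , 2) ∷ (11 , 3) ∷
  (11 , 7) ∷ (11 , 8) ∷ (11 , 9) ∷ (11 , 10) ∷ (11 , 11) ∷ (12 , 6) ∷ (12 , 7) ∷ (12 , 8) ∷
  (12 , 9) ∷ (12 , 10) ∷ (12 , 12) ∷ (13 , 3) ∷ (13 , 6) ∷ (13 , 7) ∷ (13 , 8) ∷ (13 , 9) ∷
  (13 , 11) ∷ (13 , 13) ∷ (14 , 7) ∷ (14 , 8) ∷ (14 , 10) ∷ (14 , 13) ∷ (14 , 14) ∷ (15 , 14) ∷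
  (15 , 15) ∷ []
numerator s18 = (0 , 0) ∷ (1 , 1) ∷ (2 , 0) ∷ (2 , 1) ∷ (2 , 2) ∷ (3 , 1) ∷ (3 , 2) ∷ (3 , 3) ∷
  (4 , 1) ∷ (4 , 2) ∷ (4 , 4) ∷ (5 , 3) ∷ (5 , 5) ∷ (6 , 1) ∷ (6 , 5) ∷ (6 , 6) ∷ (7 , 1) ∷
  (7 , 3) ∷ (7 , 4) ∷ (7 , 6) ∷ (7 , 7) ∷ (8 , 3) ∷ (8 , 4) ∷ (8 , 8) ∷ (9 , 1) ∷ (9 , 2) ∷
  (9 , 4) ∷ (9 , 5) ∷ (9 , 9) ∷ (10 , 2) ∷ (10 , 6) ∷ (10 , 8) ∷ (10 , 9) ∷ (10 , 10) ∷ (11 , 2) ∷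
  (11 , 3) ∷ (11 , 7) ∷ (11 , 9) ∷ (11 , 10) ∷ (11 , 11) ∷ (12 , 3) ∷ (12 , 6) ∷ (12 , 7) ∷
  (12 , 8) ∷ (12 , 9) ∷ (12 , 10) ∷ (12 , 12) ∷ (13 , 2) ∷ (13 , 3) ∷ (13 , 7) ∷ (13 , 8) ∷
  (13 , 9) ∷ (13 , 11) ∷ (13 , 13) ∷ (14 , 5) ∷ (14 , 7) ∷ (14 , 8) ∷ (14 , 9) ∷ (14 , 10) ∷
  (14 , 13) ∷ (14 , 14) ∷ (15 , 12) ∷ (15 , 14) ∷ (15 , 15) ∷ []
numerator s19 = (1 , 0) ∷ (3 , 0) ∷ (3 , 1) ∷ (3 , 2) ∷ (4 , 0) ∷ (4 , 1) ∷ (5 , 0) ∷ (5 , 4) ∷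
  (6 , 1) ∷ (6 , 3) ∷ (7 , 2) ∷ (7 , 4) ∷ (7 , 5) ∷ (7 , 6) ∷ (8 , 1) ∷ (9 , 2) ∷ (9 , 3) ∷
  (9 , 4) ∷ (9 , 8) ∷ (10 , 1) ∷ (11 , 1) ∷ (11 , 6) ∷ (11 , 8) ∷ (11 , 9) ∷ (11 , 10) ∷ (12 , 1) ∷
  (12 , 3) ∷ (12 , 8) ∷ (12 , 9) ∷ (13 , 2) ∷ (13 , 4) ∷ (13 , 6) ∷ (13 , 7) ∷ (13 , 12) ∷
  (14 , 5) ∷ (14 , 6) ∷ (14 , 7) ∷ (14 , 9) ∷ (14 , 11) ∷ (15 , 12) ∷ (15 , 13) ∷ (15 , 14) ∷ []
numerator s20 = (0 , 0) ∷ (1 , 0) ∷ (2 , 2) ∷ (3 , 1) ∷ (4 , 4) ∷ (5 , 3) ∷ (5 , 4) ∷ (6 , 1) ∷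
  (6 , 3) ∷ (6 , 6) ∷ (7 , 1) ∷ (7 , 2) ∷ (8 , 1) ∷ (8 , 4) ∷ (8 , 8) ∷ (9 , 8) ∷ (10 , 2) ∷
  (10 , 6) ∷ (10 , 10) ∷ (11 , 6) ∷ (11 , 9) ∷ (12 , 3) ∷ (12 , 8) ∷ (12 , 12) ∷ (13 , 2) ∷
  (13 , 3) ∷ (13 , 4) ∷ (13 , 7) ∷ (13 , 11) ∷ (13 , 12) ∷ (14 , 9) ∷ (14 , 10) ∷ (14 , 11) ∷
  (14 , 14) ∷ []
numerator s21 = (0 , 0) ∷ (1 , 0) ∷ (1 , 1) ∷ (2 , 0) ∷ (2 , 1) ∷ (2 , 2) ∷ (3 , 0) ∷ (3 , 1) ∷
  (3 , 3) ∷ (4 , 2) ∷ (4 , 4) ∷ (5 , 0) ∷ (5 , 3) ∷ (5 , 4) ∷ (5 , 5) ∷ (6 , 3) ∷ (6 , 5) ∷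
  (6 , 6) ∷ (7 , 1) ∷ (7 , 2) ∷ (7 , 3) ∷ (7 , 7) ∷ (8 , 1) ∷ (8 , 3) ∷ (8 , 4) ∷ (8 , 8) ∷
  (9 , 1) ∷ (9 , 5) ∷ (9 , 8) ∷ (9 , 9) ∷ (10 , 1) ∷ (10 , 2) ∷ (10 , 6) ∷ (10 , 8) ∷ (10 , 9) ∷
  (10 , 10) ∷ (11 , 2) ∷ (11 , 3) ∷ (11 , 6) ∷ (11 , 7) ∷ (11 , 8) ∷ (11 , 9) ∷ (11 , 11) ∷
  (12 , 1) ∷ (12 , 6) ∷ (12 , 7) ∷ (12 , 8) ∷ (12 , 10) ∷ (12 , 12) ∷ (13 , 3) ∷ (13 , 4) ∷
  (13 , 6) ∷ (13 , 7) ∷ (13 , 8) ∷ (13 , 9) ∷ (13 , 11) ∷ (13 , 12) ∷ (13 , 13) ∷ (14 , 8) ∷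
  (14 , 10) ∷ (14 , 11) ∷ (14 , 13) ∷ (14 , 14) ∷ (15 , 15) ∷ []
numerator s22 = (2 , 0) ∷ (3 , 1) ∷ (4 , 0) ∷ (6 , 4) ∷ (7 , 1) ∷ (7 , 3) ∷ (7 , 5) ∷ (8 , 2) ∷
  (9 , 1) ∷ (9 , 3) ∷ (10 , 8) ∷ (11 , 1) ∷ (11 , 9) ∷ (12 , 6) ∷ (12 , 8) ∷ (13 , 3) ∷ (13 , 7) ∷
  (14 , 2) ∷ (14 , 4) ∷ (14 , 6) ∷ (14 , 12) ∷ (15 , 9) ∷ (15 , 11) ∷ (15 , 13) ∷ []
numerator s23 = (0 , 0) ∷ (1 , 1) ∷ (2 , 2) ∷ (3 , 3) ∷ (4 , 2) ∷ (4 , 4) ∷ (5 , 1) ∷ (5 , 3) ∷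
  (5 , 5) ∷ (6 , 2) ∷ (6 , 4) ∷ (6 , 6) ∷ (7 , 1) ∷ (7 , 3) ∷ (7 , 5) ∷ (7 , 7) ∷ (8 , 2) ∷
  (8 , 4) ∷ (8 , 8) ∷ (9 , 3) ∷ (9 , 5) ∷ (9 , 9) ∷ (10 , 6) ∷ (10 , 10) ∷ (11 , 7) ∷ (11 , 11) ∷
  (12 , 2) ∷ (12 , 4) ∷ (12 , 8) ∷ (12 , 10) ∷ (12 , 12) ∷ (13 , 5) ∷ (13 , 11) ∷ (13 , 13) ∷
  (14 , 6) ∷ (14 , 8) ∷ (14 , 12) ∷ (14 , 14) ∷ (15 , 13) ∷ (15 , 15) ∷ []
numerator s24 = (1 , 0) ∷ (2 , 0) ∷ (3 , 2) ∷ (4 , 1) ∷ (5 , 4) ∷ (6 , 3) ∷ (6 , 4) ∷ (7 , 1) ∷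
  (7 , 3) ∷ (7 , 6) ∷ (8 , 1) ∷ (8 , 2) ∷ (9 , 1) ∷ (9 , 4) ∷ (9 , 8) ∷ (10 , 8) ∷ (11 , 2) ∷
  (11 , 6) ∷ (11 , 10) ∷ (12 , 6) ∷ (12 , 9) ∷ (13 , 3) ∷ (13 , 8) ∷ (13 , 12) ∷ (14 , 2) ∷
  (14 , 3) ∷ (14 , 4) ∷ (14 , 7) ∷ (14 , 11) ∷ (14 , 12) ∷ (15 , 9) ∷ (15 , 10) ∷ (15 , 11) ∷
  (15 , 14) ∷ []
numerator s25 = (3 , 0) ∷ (5 , 0) ∷ (6 , 0) ∷ (6 , 1) ∷ (7 , 1) ∷ (7 , 2) ∷ (7 , 4) ∷ (9 , 2) ∷
  (10 , 1) ∷ (11 , 2) ∷ (11 , 8) ∷ (12 , 1) ∷ (12 , 2) ∷ (12 , 3) ∷ (13 , 1) ∷ (13 , 2) ∷ (13 , 3) ∷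
  (13 , 4) ∷ (13 , 6) ∷ (13 , 8) ∷ (14 , 2) ∷ (14 , 3) ∷ (14 , 5) ∷ (14 , 8) ∷ (14 , 9) ∷ (15 , 9) ∷
  (15 , 10) ∷ (15 , 12) ∷ []
numerator s26 = (1 , 0) ∷ (2 , 0) ∷ (3 , 1) ∷ (3 , 2) ∷ (4 , 1) ∷ (5 , 1) ∷ (5 , 4) ∷ (6 , 1) ∷
  (6 , 2) ∷ (6 , 3) ∷ (6 , 4) ∷ (7 , 2) ∷ (7 , 5) ∷ (7 , 6) ∷ (8 , 1) ∷ (8 , 2) ∷ (9 , 1) ∷
  (9 , 3) ∷ (9 , 4) ∷ (9 , 8) ∷ (10 , 2) ∷ (10 , 8) ∷ (11 , 2) ∷ (11 , 3) ∷ (11 , 6) ∷ (11 , 9) ∷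
  (11 , 10) ∷ (12 , 2) ∷ (12 , 3) ∷ (12 , 4) ∷ (12 , 6) ∷ (12 , 9) ∷ (13 , 2) ∷ (13 , 3) ∷
  (13 , 4) ∷ (13 , 5) ∷ (13 , 7) ∷ (13 , 8) ∷ (13 , 9) ∷ (13 , 12) ∷ (14 , 6) ∷ (14 , 7) ∷
  (14 , 9) ∷ (14 , 10) ∷ (14 , 11) ∷ (14 , 12) ∷ (15 , 13) ∷ (15 , 14) ∷ []
numerator s27 = (2 , 0) ∷ (3 , 0) ∷ (3 , 1) ∷ (4 , 0) ∷ (6 , 1) ∷ (6 , 4) ∷ (7 , 3) ∷ (7 , 4) ∷
  (7 , 5) ∷ (8 , 2) ∷ (9 , 1) ∷ (9 , 2) ∷ (9 , 3) ∷ (10 , 1) ∷ (10 , 8) ∷ (11 , 1) ∷ (11 , 8) ∷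
  (11 , 9) ∷ (12 , 3) ∷ (12 , 6) ∷ (12 , 8) ∷ (13 , 2) ∷ (13 , 6) ∷ (13 , 7) ∷ (14 , 4) ∷ (14 , 5) ∷
  (14 , 6) ∷ (14 , 9) ∷ (14 , 12) ∷ (15 , 11) ∷ (15 , 12) ∷ (15 , 13) ∷ []
numerator s28 = (0 , 0) ∷ (1 , 1) ∷ (2 , 2) ∷ (3 , 1) ∷ (3 , 3) ∷ (4 , 2) ∷ (4 , 4) ∷ (5 , 1) ∷
  (5 , 3) ∷ (5 , 5) ∷ (6 , 1) ∷ (6 , 4) ∷ (6 , 6) ∷ (7 , 1) ∷ (7 , 3) ∷ (7 , 7) ∷ (8 , 2) ∷
  (8 , 4) ∷ (8 , 8) ∷ (9 , 5) ∷ (9 , 9) ∷ (10 , 2) ∷ (10 , 6) ∷ (10 , 10) ∷ (11 , 7) ∷ (11 , 9) ∷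
  (11 , 11) ∷ (12 , 2) ∷ (12 , 3) ∷ (12 , 8) ∷ (12 , 10) ∷ (12 , 12) ∷ (13 , 2) ∷ (13 , 3) ∷
  (13 , 5) ∷ (13 , 7) ∷ (13 , 11) ∷ (13 , 13) ∷ (14 , 8) ∷ (14 , 9) ∷ (14 , 10) ∷ (14 , 12) ∷
  (14 , 14) ∷ (15 , 15) ∷ []
numerator s29 = (2 , 0) ∷ (6 , 4) ∷ (7 , 3) ∷ (8 , 2) ∷ (9 , 1) ∷ (10 , 8) ∷ (12 , 6) ∷ (14 , 4) ∷
  (14 , 12) ∷ (15 , 11) ∷ []
numerator s30 = (3 , 0) ∷ (5 , 0) ∷ (6 , 1) ∷ (7 , 2) ∷ (7 , 4) ∷ (9 , 2) ∷ (10 , 1) ∷ (11 , 2) ∷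
  (11 , 8) ∷ (12 , 1) ∷ (12 , 3) ∷ (13 , 2) ∷ (13 , 4) ∷ (13 , 6) ∷ (13 , 8) ∷ (14 , 3) ∷ (14 , 5) ∷
  (14 , 9) ∷ (15 , 10) ∷ (15 , 12) ∷ []
numerator s31 = (1 , 0) ∷ (3 , 2) ∷ (4 , 1) ∷ (5 , 4) ∷ (6 , 1) ∷ (6 , 3) ∷ (7 , 2) ∷ (7 , 6) ∷
  (8 , 1) ∷ (9 , 4) ∷ (9 , 8) ∷ (11 , 2) ∷ (11 , 6) ∷ (11 , 10) ∷ (12 , 3) ∷ (12 , 9) ∷ (13 , 2) ∷
  (13 , 4) ∷ (13 , 8) ∷ (13 , 12) ∷ (14 , 7) ∷ (14 , 9) ∷ (14 , 11) ∷ (15 , 14) ∷ []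
numerator s32 = (3 , 0) ∷ (6 , 1) ∷ (7 , 4) ∷ (9 , 2) ∷ (10 , 1) ∷ (11 , 8) ∷ (12 , 3) ∷ (13 , 2) ∷
  (13 , 6) ∷ (14 , 5) ∷ (14 , 9) ∷ (15 , 12) ∷ []
numerator s33 = (6 , 0) ∷ (12 , 2) ∷ (13 , 1) ∷ (14 , 8) ∷ []
numerator s34 = (0 , 0) ∷ (1 , 1) ∷ (2 , 1) ∷ (2 , 2) ∷ (3 , 2) ∷ (3 , 3) ∷ (4 , 1) ∷ (4 , 2) ∷
  (4 , 4) ∷ (5 , 1) ∷ (5 , 3) ∷ (5 , 5) ∷ (6 , 2) ∷ (6 , 4) ∷ (6 , 5) ∷ (6 , 6) ∷ (7 , 1) ∷
  (7 , 2) ∷ (7 , 3) ∷ (7 , 4) ∷ (7 , 5) ∷ (7 , 6) ∷ (7 , 7) ∷ (8 , 2) ∷ (8 , 3) ∷ (8 , 4) ∷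
  (8 , 8) ∷ (9 , 2) ∷ (9 , 3) ∷ (9 , 4) ∷ (9 , 5) ∷ (9 , 9) ∷ (10 , 6) ∷ (10 , 9) ∷ (10 , 10) ∷
  (11 , 2) ∷ (11 , 7) ∷ (11 , 10) ∷ (11 , 11) ∷ (12 , 2) ∷ (12 , 4) ∷ (12 , 7) ∷ (12 , 8) ∷
  (12 , 9) ∷ (12 , 10) ∷ (12 , 12) ∷ (13 , 4) ∷ (13 , 5) ∷ (13 , 8) ∷ (13 , 11) ∷ (13 , 13) ∷
  (14 , 3) ∷ (14 , 5) ∷ (14 , 6) ∷ (14 , 7) ∷ (14 , 8) ∷ (14 , 12) ∷ (14 , 13) ∷ (14 , 14) ∷
  (15 , 10) ∷ (15 , 12) ∷ (15 , 13) ∷ (15 , 14) ∷ (15 , 15) ∷ []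
numerator s35 = (1 , 1) ∷ (3 , 2) ∷ (3 , 3) ∷ (4 , 1) ∷ (4 , 2) ∷ (5 , 1) ∷ (5 , 5) ∷ (6 , 1) ∷
  (6 , 4) ∷ (7 , 3) ∷ (7 , 6) ∷ (7 , 7) ∷ (8 , 2) ∷ (9 , 4) ∷ (9 , 5) ∷ (9 , 9) ∷ (11 , 2) ∷
  (11 , 7) ∷ (11 , 10) ∷ (11 , 11) ∷ (12 , 2) ∷ (12 , 3) ∷ (12 , 9) ∷ (12 , 10) ∷ (13 , 2) ∷
  (13 , 5) ∷ (13 , 8) ∷ (13 , 13) ∷ (14 , 7) ∷ (14 , 8) ∷ (14 , 9) ∷ (14 , 12) ∷ (15 , 14) ∷
  (15 , 15) ∷ []
numerator s36 = (0 , 0) ∷ (1 , 0) ∷ (1 , 1) ∷ (2 , 1) ∷ (2 , 2) ∷ (3 , 0) ∷ (3 , 3) ∷ (4 , 2) ∷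
  (4 , 4) ∷ (5 , 1) ∷ (5 , 3) ∷ (5 , 4) ∷ (5 , 5) ∷ (6 , 1) ∷ (6 , 2) ∷ (6 , 3) ∷ (6 , 4) ∷
  (6 , 5) ∷ (6 , 6) ∷ (7 , 1) ∷ (7 , 2) ∷ (7 , 3) ∷ (7 , 5) ∷ (7 , 7) ∷ (8 , 1) ∷ (8 , 2) ∷
  (8 , 3) ∷ (8 , 4) ∷ (8 , 8) ∷ (9 , 3) ∷ (9 , 5) ∷ (9 , 8) ∷ (9 , 9) ∷ (10 , 1) ∷ (10 , 6) ∷
  (10 , 9) ∷ (10 , 10) ∷ (11 , 6) ∷ (11 , 7) ∷ (11 , 8) ∷ (11 , 11) ∷ (12 , 2) ∷ (12 , 3) ∷
  (12 , 4) ∷ (12 , 7) ∷ (12 , 8) ∷ (12 , 10) ∷ (12 , 12) ∷ (13 , 2) ∷ (13 , 4) ∷ (13 , 5) ∷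
  (13 , 6) ∷ (13 , 11) ∷ (13 , 12) ∷ (13 , 13) ∷ (14 , 6) ∷ (14 , 8) ∷ (14 , 9) ∷ (14 , 11) ∷
  (14 , 12) ∷ (14 , 13) ∷ (14 , 14) ∷ (15 , 13) ∷ (15 , 15) ∷ []
numerator s37 = (1 , 1) ∷ (3 , 3) ∷ (4 , 2) ∷ (5 , 1) ∷ (5 , 5) ∷ (6 , 4) ∷ (7 , 3) ∷ (7 , 7) ∷
  (8 , 2) ∷ (9 , 5) ∷ (9 , 9) ∷ (11 , 7) ∷ (11 , 11) ∷ (12 , 2) ∷ (12 , 10) ∷ (13 , 5) ∷ (13 , 13) ∷
  (14 , 8) ∷ (14 , 12) ∷ (15 , 15) ∷ []
numerator s38 = (1 , 0) ∷ (2 , 1) ∷ (3 , 0) ∷ (5 , 4) ∷ (6 , 1) ∷ (6 , 3) ∷ (6 , 5) ∷ (7 , 2) ∷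
  (8 , 1) ∷ (8 , 3) ∷ (9 , 8) ∷ (10 , 1) ∷ (10 , 9) ∷ (11 , 6) ∷ (11 , 8) ∷ (12 , 3) ∷ (12 , 7) ∷
  (13 , 2) ∷ (13 , 4) ∷ (13 , 6) ∷ (13 , 12) ∷ (14 , 9) ∷ (14 , 11) ∷ (14 , 13) ∷ []
numerator s39 = (1 , 0) ∷ (2 , 0) ∷ (3 , 2) ∷ (4 , 1) ∷ (5 , 0) ∷ (5 , 4) ∷ (6 , 3) ∷ (6 , 4) ∷
  (7 , 2) ∷ (7 , 3) ∷ (7 , 6) ∷ (8 , 1) ∷ (8 , 2) ∷ (9 , 1) ∷ (9 , 4) ∷ (9 , 8) ∷ (10 , 8) ∷
  (11 , 6) ∷ (11 , 10) ∷ (12 , 1) ∷ (12 , 6) ∷ (12 , 9) ∷ (13 , 4) ∷ (13 , 12) ∷ (14 , 4) ∷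
  (14 , 7) ∷ (14 , 11) ∷ (14 , 12) ∷ (15 , 11) ∷ (15 , 14) ∷ []
numerator s40 = (1 , 0) ∷ (1 , 1) ∷ (3 , 3) ∷ (4 , 2) ∷ (5 , 1) ∷ (5 , 4) ∷ (5 , 5) ∷ (6 , 3) ∷
  (6 , 4) ∷ (7 , 2) ∷ (7 , 3) ∷ (7 , 7) ∷ (8 , 1) ∷ (8 , 2) ∷ (9 , 5) ∷ (9 , 8) ∷ (9 , 9) ∷
  (11 , 6) ∷ (11 , 7) ∷ (11 , 11) ∷ (12 , 2) ∷ (12 , 10) ∷ (13 , 4) ∷ (13 , 5) ∷ (13 , 12) ∷
  (13 , 13) ∷ (14 , 8) ∷ (14 , 11) ∷ (14 , 12) ∷ (15 , 15) ∷ []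
numerator s41 = (2 , 0) ∷ (3 , 0) ∷ (3 , 1) ∷ (4 , 0) ∷ (5 , 0) ∷ (6 , 0) ∷ (6 , 1) ∷ (6 , 4) ∷
  (7 , 2) ∷ (7 , 3) ∷ (7 , 4) ∷ (7 , 5) ∷ (8 , 2) ∷ (9 , 1) ∷ (9 , 2) ∷ (9 , 3) ∷ (10 , 1) ∷
  (10 , 8) ∷ (11 , 1) ∷ (11 , 2) ∷ (11 , 8) ∷ (11 , 9) ∷ (12 , 1) ∷ (12 , 2) ∷ (12 , 3) ∷ (12 , 6) ∷
  (12 , 8) ∷ (13 , 1) ∷ (13 , 2) ∷ (13 , 4) ∷ (13 , 6) ∷ (13 , 7) ∷ (13 , 8) ∷ (14 , 3) ∷ (14 , 4) ∷
  (14 , 5) ∷ (14 , 6) ∷ (14 , 8) ∷ (14 , 9) ∷ (14 , 12) ∷ (15 , 10) ∷ (15 , 11) ∷ (15 , 12) ∷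
  (15 , 13) ∷ []
numerator s42 = (0 , 0) ∷ (1 , 0) ∷ (1 , 1) ∷ (2 , 0) ∷ (2 , 2) ∷ (3 , 1) ∷ (3 , 2) ∷ (3 , 3) ∷
  (4 , 1) ∷ (4 , 2) ∷ (4 , 4) ∷ (5 , 3) ∷ (5 , 4) ∷ (5 , 5) ∷ (6 , 1) ∷ (6 , 3) ∷ (6 , 6) ∷
  (7 , 1) ∷ (7 , 2) ∷ (7 , 3) ∷ (7 , 6) ∷ (7 , 7) ∷ (8 , 1) ∷ (8 , 4) ∷ (8 , 8) ∷ (9 , 1) ∷
  (9 , 4) ∷ (9 , 5) ∷ (9 , 8) ∷ (9 , 9) ∷ (10 , 2) ∷ (10 , 6) ∷ (10 , 8) ∷ (10 , 10) ∷ (11 , 2) ∷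
  (11 , 3) ∷ (11 , 6) ∷ (11 , 7) ∷ (11 , 9) ∷ (11 , 10) ∷ (11 , 11) ∷ (12 , 3) ∷ (12 , 6) ∷
  (12 , 8) ∷ (12 , 9) ∷ (12 , 10) ∷ (12 , 12) ∷ (13 , 2) ∷ (13 , 3) ∷ (13 , 4) ∷ (13 , 7) ∷
  (13 , 8) ∷ (13 , 9) ∷ (13 , 11) ∷ (13 , 12) ∷ (13 , 13) ∷ (14 , 7) ∷ (14 , 8) ∷ (14 , 9) ∷
  (14 , 10) ∷ (14 , 11) ∷ (14 , 14) ∷ (15 , 14) ∷ (15 , 15) ∷ []
numerator s43 = (3 , 0) ∷ (3 , 1) ∷ (4 , 0) ∷ (6 , 1) ∷ (7 , 4) ∷ (7 , 5) ∷ (9 , 2) ∷ (9 , 3) ∷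
  (10 , 1) ∷ (11 , 1) ∷ (11 , 8) ∷ (11 , 9) ∷ (12 , 3) ∷ (12 , 8) ∷ (13 , 2) ∷ (13 , 6) ∷ (13 , 7) ∷
  (14 , 5) ∷ (14 , 6) ∷ (14 , 9) ∷ (15 , 12) ∷ (15 , 13) ∷ []
numerator s44 = (0 , 0) ∷ (2 , 2) ∷ (3 , 1) ∷ (4 , 4) ∷ (5 , 3) ∷ (6 , 1) ∷ (6 , 6) ∷ (7 , 1) ∷
  (8 , 4) ∷ (8 , 8) ∷ (10 , 2) ∷ (10 , 6) ∷ (10 , 10) ∷ (11 , 9) ∷ (12 , 3) ∷ (12 , 8) ∷ (12 , 12) ∷
  (13 , 2) ∷ (13 , 3) ∷ (13 , 7) ∷ (13 , 11) ∷ (14 , 9) ∷ (14 , 10) ∷ (14 , 14) ∷ []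
numerator s45 = (0 , 0) ∷ (1 , 0) ∷ (2 , 0) ∷ (2 , 2) ∷ (3 , 1) ∷ (4 , 4) ∷ (5 , 1) ∷ (5 , 3) ∷
  (5 , 4) ∷ (6 , 3) ∷ (6 , 4) ∷ (6 , 6) ∷ (7 , 1) ∷ (7 , 2) ∷ (8 , 1) ∷ (8 , 2) ∷ (8 , 4) ∷
  (8 , 8) ∷ (9 , 1) ∷ (9 , 8) ∷ (10 , 2) ∷ (10 , 6) ∷ (10 , 8) ∷ (10 , 10) ∷ (11 , 3) ∷ (11 , 6) ∷
  (11 , 9) ∷ (12 , 2) ∷ (12 , 6) ∷ (12 , 8) ∷ (12 , 12) ∷ (13 , 3) ∷ (13 , 4) ∷ (13 , 5) ∷
  (13 , 7) ∷ (13 , 9) ∷ (13 , 11) ∷ (13 , 12) ∷ (14 , 10) ∷ (14 , 11) ∷ (14 , 12) ∷ (14 , 14) ∷ []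
numerator s46 = (1 , 0) ∷ (3 , 2) ∷ (4 , 1) ∷ (5 , 4) ∷ (6 , 3) ∷ (7 , 1) ∷ (7 , 6) ∷ (8 , 1) ∷
  (9 , 4) ∷ (9 , 8) ∷ (11 , 2) ∷ (11 , 6) ∷ (11 , 10) ∷ (12 , 9) ∷ (13 , 3) ∷ (13 , 8) ∷ (13 , 12) ∷
  (14 , 2) ∷ (14 , 3) ∷ (14 , 7) ∷ (14 , 11) ∷ (15 , 9) ∷ (15 , 10) ∷ (15 , 14) ∷ []
numerator s47 = (3 , 0) ∷ (6 , 1) ∷ (7 , 1) ∷ (7 , 4) ∷ (9 , 2) ∷ (10 , 1) ∷ (11 , 8) ∷ (12 , 3) ∷
  (13 , 2) ∷ (13 , 3) ∷ (13 , 6) ∷ (14 , 2) ∷ (14 , 5) ∷ (14 , 9) ∷ (15 , 9) ∷ (15 , 12) ∷ []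
numerator s48 = (3 , 0) ∷ (6 , 0) ∷ (6 , 1) ∷ (7 , 4) ∷ (9 , 2) ∷ (10 , 1) ∷ (11 , 8) ∷ (12 , 2) ∷
  (12 , 3) ∷ (13 , 1) ∷ (13 , 2) ∷ (13 , 6) ∷ (14 , 5) ∷ (14 , 8) ∷ (14 , 9) ∷ (15 , 12) ∷ []
numerator s49 = (1 , 0) ∷ (3 , 1) ∷ (3 , 2) ∷ (4 , 1) ∷ (5 , 1) ∷ (5 , 4) ∷ (6 , 1) ∷ (6 , 2) ∷
  (6 , 3) ∷ (7 , 2) ∷ (7 , 3) ∷ (7 , 5) ∷ (7 , 6) ∷ (8 , 1) ∷ (9 , 3) ∷ (9 , 4) ∷ (9 , 8) ∷
  (10 , 2) ∷ (11 , 2) ∷ (11 , 3) ∷ (11 , 6) ∷ (11 , 9) ∷ (11 , 10) ∷ (12 , 2) ∷ (12 , 3) ∷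
  (12 , 4) ∷ (12 , 9) ∷ (13 , 2) ∷ (13 , 3) ∷ (13 , 4) ∷ (13 , 5) ∷ (13 , 7) ∷ (13 , 8) ∷ (13 , 9) ∷
  (13 , 12) ∷ (14 , 4) ∷ (14 , 6) ∷ (14 , 7) ∷ (14 , 9) ∷ (14 , 10) ∷ (14 , 11) ∷ (15 , 11) ∷
  (15 , 13) ∷ (15 , 14) ∷ []
numerator s50 = (1 , 0) ∷ (2 , 0) ∷ (3 , 2) ∷ (4 , 0) ∷ (4 , 1) ∷ (5 , 1) ∷ (5 , 4) ∷ (6 , 1) ∷
  (6 , 2) ∷ (6 , 3) ∷ (6 , 4) ∷ (7 , 2) ∷ (7 , 6) ∷ (8 , 1) ∷ (8 , 2) ∷ (9 , 1) ∷ (9 , 4) ∷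
  (9 , 8) ∷ (10 , 2) ∷ (10 , 8) ∷ (11 , 1) ∷ (11 , 2) ∷ (11 , 3) ∷ (11 , 6) ∷ (11 , 10) ∷ (12 , 2) ∷
  (12 , 3) ∷ (12 , 4) ∷ (12 , 6) ∷ (12 , 8) ∷ (12 , 9) ∷ (13 , 2) ∷ (13 , 3) ∷ (13 , 4) ∷ (13 , 5) ∷
  (13 , 8) ∷ (13 , 9) ∷ (13 , 12) ∷ (14 , 7) ∷ (14 , 9) ∷ (14 , 10) ∷ (14 , 11) ∷ (14 , 12) ∷
  (15 , 14) ∷ []
numerator s51 = (1 , 0) ∷ (2 , 0) ∷ (3 , 2) ∷ (4 , 1) ∷ (5 , 4) ∷ (6 , 3) ∷ (6 , 4) ∷ (7 , 3) ∷
  (7 , 6) ∷ (8 , 1) ∷ (8 , 2) ∷ (9 , 1) ∷ (9 , 4) ∷ (9 , 8) ∷ (10 , 8) ∷ (11 , 2) ∷ (11 , 6) ∷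
  (11 , 10) ∷ (12 , 6) ∷ (12 , 9) ∷ (13 , 8) ∷ (13 , 12) ∷ (14 , 3) ∷ (14 , 4) ∷ (14 , 7) ∷
  (14 , 11) ∷ (14 , 12) ∷ (15 , 10) ∷ (15 , 11) ∷ (15 , 14) ∷ []
numerator s52 = (1 , 0) ∷ (3 , 1) ∷ (3 , 2) ∷ (4 , 0) ∷ (4 , 1) ∷ (5 , 0) ∷ (5 , 4) ∷ (6 , 3) ∷
  (7 , 2) ∷ (7 , 5) ∷ (7 , 6) ∷ (8 , 1) ∷ (9 , 3) ∷ (9 , 4) ∷ (9 , 8) ∷ (11 , 1) ∷ (11 , 6) ∷
  (11 , 9) ∷ (11 , 10) ∷ (12 , 1) ∷ (12 , 8) ∷ (12 , 9) ∷ (13 , 4) ∷ (13 , 7) ∷ (13 , 12) ∷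
  (14 , 6) ∷ (14 , 7) ∷ (14 , 11) ∷ (15 , 13) ∷ (15 , 14) ∷ []
numerator s53 = (0 , 0) ∷ (1 , 1) ∷ (2 , 1) ∷ (2 , 2) ∷ (3 , 2) ∷ (3 , 3) ∷ (4 , 1) ∷ (4 , 2) ∷
  (4 , 4) ∷ (5 , 1) ∷ (5 , 3) ∷ (5 , 5) ∷ (6 , 1) ∷ (6 , 2) ∷ (6 , 4) ∷ (6 , 5) ∷ (6 , 6) ∷
  (7 , 1) ∷ (7 , 3) ∷ (7 , 4) ∷ (7 , 5) ∷ (7 , 6) ∷ (7 , 7) ∷ (8 , 2) ∷ (8 , 3) ∷ (8 , 4) ∷
  (8 , 8) ∷ (9 , 2) ∷ (9 , 3) ∷ (9 , 4) ∷ (9 , 5) ∷ (9 , 9) ∷ (10 , 6) ∷ (10 , 9) ∷ (10 , 10) ∷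
  (11 , 2) ∷ (11 , 7) ∷ (11 , 10) ∷ (11 , 11) ∷ (12 , 2) ∷ (12 , 3) ∷ (12 , 4) ∷ (12 , 7) ∷
  (12 , 8) ∷ (12 , 9) ∷ (12 , 10) ∷ (12 , 12) ∷ (13 , 2) ∷ (13 , 5) ∷ (13 , 8) ∷ (13 , 11) ∷
  (13 , 13) ∷ (14 , 5) ∷ (14 , 6) ∷ (14 , 7) ∷ (14 , 8) ∷ (14 , 9) ∷ (14 , 12) ∷ (14 , 13) ∷
  (14 , 14) ∷ (15 , 12) ∷ (15 , 13) ∷ (15 , 14) ∷ (15 , 15) ∷ []
numerator s54 = (6 , 1) ∷ (12 , 3) ∷ (13 , 2) ∷ (14 , 9) ∷ []
numerator s55 = (0 , 0) ∷ (1 , 0) ∷ (1 , 1) ∷ (2 , 0) ∷ (2 , 1) ∷ (2 , 2) ∷ (3 , 0) ∷ (3 , 1) ∷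
  (3 , 3) ∷ (4 , 2) ∷ (4 , 4) ∷ (5 , 3) ∷ (5 , 4) ∷ (5 , 5) ∷ (6 , 1) ∷ (6 , 3) ∷ (6 , 5) ∷
  (6 , 6) ∷ (7 , 1) ∷ (7 , 2) ∷ (7 , 3) ∷ (7 , 7) ∷ (8 , 1) ∷ (8 , 3) ∷ (8 , 4) ∷ (8 , 8) ∷
  (9 , 1) ∷ (9 , 5) ∷ (9 , 8) ∷ (9 , 9) ∷ (10 , 1) ∷ (10 , 2) ∷ (10 , 6) ∷ (10 , 8) ∷ (10 , 9) ∷
  (10 , 10) ∷ (11 , 3) ∷ (11 , 6) ∷ (11 , 7) ∷ (11 , 8) ∷ (11 , 9) ∷ (11 , 11) ∷ (12 , 3) ∷
  (12 , 6) ∷ (12 , 7) ∷ (12 , 8) ∷ (12 , 10) ∷ (12 , 12) ∷ (13 , 2) ∷ (13 , 3) ∷ (13 , 4) ∷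
  (13 , 6) ∷ (13 , 7) ∷ (13 , 9) ∷ (13 , 11) ∷ (13 , 12) ∷ (13 , 13) ∷ (14 , 8) ∷ (14 , 9) ∷
  (14 , 10) ∷ (14 , 11) ∷ (14 , 13) ∷ (14 , 14) ∷ (15 , 15) ∷ []
numerator s56 = (1 , 1) ∷ (3 , 1) ∷ (3 , 2) ∷ (3 , 3) ∷ (4 , 1) ∷ (4 , 2) ∷ (5 , 1) ∷ (5 , 5) ∷
  (6 , 2) ∷ (6 , 4) ∷ (7 , 3) ∷ (7 , 5) ∷ (7 , 6) ∷ (7 , 7) ∷ (8 , 2) ∷ (9 , 3) ∷ (9 , 4) ∷
  (9 , 5) ∷ (9 , 9) ∷ (10 , 2) ∷ (11 , 2) ∷ (11 , 7) ∷ (11 , 9) ∷ (11 , 10) ∷ (11 , 11) ∷ (12 , 2) ∷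
  (12 , 4) ∷ (12 , 9) ∷ (12 , 10) ∷ (13 , 3) ∷ (13 , 5) ∷ (13 , 7) ∷ (13 , 8) ∷ (13 , 13) ∷
  (14 , 6) ∷ (14 , 7) ∷ (14 , 8) ∷ (14 , 10) ∷ (14 , 12) ∷ (15 , 13) ∷ (15 , 14) ∷ (15 , 15) ∷ []
numerator s57 = (2 , 1) ∷ (3 , 2) ∷ (4 , 1) ∷ (6 , 1) ∷ (6 , 5) ∷ (7 , 4) ∷ (7 , 6) ∷ (8 , 3) ∷
  (9 , 2) ∷ (9 , 4) ∷ (10 , 9) ∷ (11 , 2) ∷ (11 , 10) ∷ (12 , 3) ∷ (12 , 7) ∷ (12 , 9) ∷ (13 , 2) ∷
  (13 , 8) ∷ (14 , 5) ∷ (14 , 7) ∷ (14 , 9) ∷ (14 , 13) ∷ (15 , 12) ∷ (15 , 14) ∷ []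
numerator s58 = (1 , 1) ∷ (3 , 3) ∷ (4 , 2) ∷ (5 , 1) ∷ (5 , 5) ∷ (6 , 1) ∷ (6 , 4) ∷ (7 , 3) ∷
  (7 , 7) ∷ (8 , 2) ∷ (9 , 5) ∷ (9 , 9) ∷ (11 , 7) ∷ (11 , 11) ∷ (12 , 2) ∷ (12 , 3) ∷ (12 , 10) ∷
  (13 , 2) ∷ (13 , 5) ∷ (13 , 13) ∷ (14 , 8) ∷ (14 , 9) ∷ (14 , 12) ∷ (15 , 15) ∷ []
numerator s59 = (0 , 0) ∷ (2 , 2) ∷ (3 , 1) ∷ (4 , 4) ∷ (5 , 3) ∷ (6 , 6) ∷ (7 , 1) ∷ (8 , 4) ∷
  (8 , 8) ∷ (10 , 2) ∷ (10 , 6) ∷ (10 , 10) ∷ (11 , 9) ∷ (12 , 8) ∷ (12 , 12) ∷ (13 , 3) ∷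
  (13 , 7) ∷ (13 , 11) ∷ (14 , 10) ∷ (14 , 14) ∷ []
numerator s60 = (1 , 0) ∷ (2 , 0) ∷ (2 , 1) ∷ (3 , 0) ∷ (4 , 0) ∷ (5 , 1) ∷ (5 , 4) ∷ (6 , 1) ∷
  (6 , 2) ∷ (6 , 3) ∷ (6 , 4) ∷ (6 , 5) ∷ (7 , 2) ∷ (8 , 1) ∷ (8 , 2) ∷ (8 , 3) ∷ (9 , 1) ∷
  (9 , 8) ∷ (10 , 1) ∷ (10 , 2) ∷ (10 , 8) ∷ (10 , 9) ∷ (11 , 1) ∷ (11 , 3) ∷ (11 , 6) ∷ (11 , 8) ∷
  (12 , 2) ∷ (12 , 3) ∷ (12 , 4) ∷ (12 , 6) ∷ (12 , 7) ∷ (12 , 8) ∷ (13 , 2) ∷ (13 , 3) ∷ (13 , 4) ∷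
  (13 , 5) ∷ (13 , 6) ∷ (13 , 9) ∷ (13 , 12) ∷ (14 , 9) ∷ (14 , 10) ∷ (14 , 11) ∷ (14 , 12) ∷
  (14 , 13) ∷ []
numerator s61 = (7 , 1) ∷ (13 , 3) ∷ (14 , 2) ∷ (15 , 9) ∷ []
numerator s62 = (3 , 1) ∷ (5 , 1) ∷ (6 , 1) ∷ (6 , 2) ∷ (7 , 2) ∷ (7 , 3) ∷ (7 , 5) ∷ (9 , 3) ∷
  (10 , 2) ∷ (11 , 3) ∷ (11 , 9) ∷ (12 , 2) ∷ (12 , 3) ∷ (12 , 4) ∷ (13 , 2) ∷ (13 , 3) ∷ (13 , 4) ∷
  (13 , 5) ∷ (13 , 7) ∷ (13 , 9) ∷ (14 , 3) ∷ (14 , 4) ∷ (14 , 6) ∷ (14 , 9) ∷ (14 , 10) ∷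
  (15 , 10) ∷ (15 , 11) ∷ (15 , 13) ∷ []
numerator s63 = (2 , 0) ∷ (4 , 0) ∷ (5 , 0) ∷ (5 , 1) ∷ (6 , 1) ∷ (6 , 2) ∷ (6 , 4) ∷ (8 , 2) ∷
  (9 , 1) ∷ (10 , 2) ∷ (10 , 8) ∷ (11 , 1) ∷ (11 , 2) ∷ (11 , 3) ∷ (12 , 1) ∷ (12 , 2) ∷ (12 , 3) ∷
  (12 , 4) ∷ (12 , 6) ∷ (12 , 8) ∷ (13 , 2) ∷ (13 , 3) ∷ (13 , 5) ∷ (13 , 8) ∷ (13 , 9) ∷ (14 , 9) ∷
  (14 , 10) ∷ (14 , 12) ∷ []
numerator s64 = (2 , 1) ∷ (3 , 1) ∷ (3 , 2) ∷ (4 , 1) ∷ (5 , 1) ∷ (6 , 1) ∷ (6 , 2) ∷ (6 , 5) ∷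
  (7 , 3) ∷ (7 , 4) ∷ (7 , 5) ∷ (7 , 6) ∷ (8 , 3) ∷ (9 , 2) ∷ (9 , 3) ∷ (9 , 4) ∷ (10 , 2) ∷
  (10 , 9) ∷ (11 , 2) ∷ (11 , 3) ∷ (11 , 9) ∷ (11 , 10) ∷ (12 , 2) ∷ (12 , 3) ∷ (12 , 4) ∷
  (12 , 7) ∷ (12 , 9) ∷ (13 , 2) ∷ (13 , 3) ∷ (13 , 5) ∷ (13 , 7) ∷ (13 , 8) ∷ (13 , 9) ∷ (14 , 4) ∷
  (14 , 5) ∷ (14 , 6) ∷ (14 , 7) ∷ (14 , 9) ∷ (14 , 10) ∷ (14 , 13) ∷ (15 , 11) ∷ (15 , 12) ∷
  (15 , 13) ∷ (15 , 14) ∷ []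
numerator s65 = (3 , 1) ∷ (6 , 1) ∷ (6 , 2) ∷ (7 , 5) ∷ (9 , 3) ∷ (10 , 2) ∷ (11 , 9) ∷ (12 , 3) ∷
  (12 , 4) ∷ (13 , 2) ∷ (13 , 3) ∷ (13 , 7) ∷ (14 , 6) ∷ (14 , 9) ∷ (14 , 10) ∷ (15 , 13) ∷ []
numerator s66 = (2 , 0) ∷ (5 , 1) ∷ (6 , 1) ∷ (6 , 4) ∷ (8 , 2) ∷ (9 , 1) ∷ (10 , 8) ∷ (11 , 3) ∷
  (12 , 2) ∷ (12 , 3) ∷ (12 , 6) ∷ (13 , 2) ∷ (13 , 5) ∷ (13 , 9) ∷ (14 , 9) ∷ (14 , 12) ∷ []
numerator s67 = (3 , 1) ∷ (5 , 1) ∷ (6 , 2) ∷ (7 , 3) ∷ (7 , 5) ∷ (9 , 3) ∷ (10 , 2) ∷ (11 , 3) ∷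
  (11 , 9) ∷ (12 , 2) ∷ (12 , 4) ∷ (13 , 3) ∷ (13 , 5) ∷ (13 , 7) ∷ (13 , 9) ∷ (14 , 4) ∷ (14 , 6) ∷
  (14 , 10) ∷ (15 , 11) ∷ (15 , 13) ∷ []
numerator s68 = (2 , 0) ∷ (4 , 0) ∷ (5 , 1) ∷ (6 , 2) ∷ (6 , 4) ∷ (8 , 2) ∷ (9 , 1) ∷ (10 , 2) ∷
  (10 , 8) ∷ (11 , 1) ∷ (11 , 3) ∷ (12 , 2) ∷ (12 , 4) ∷ (12 , 6) ∷ (12 , 8) ∷ (13 , 3) ∷ (13 , 5) ∷
  (13 , 9) ∷ (14 , 10) ∷ (14 , 12) ∷ []

next : State → Bool → Bool → State
next s0 = byBits s1 s2 s3 s1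
next s1 = byBits s1 s1 s1 s1
next s2 = byBits s4 s1 s1 s5
next s3 = byBits s6 s1 s1 s7
next s4 = byBits s8 s9 s10 s11
next s5 = byBits s12 s2 s3 s13
next s6 = byBits s14 s15 s16 s17
next s7 = byBits s18 s19 s20 s21
next s8 = byBits s1 s22 s23 s1
next s9 = byBits s24 s25 s26 s19
next s10 = byBits s14 s27 s28 s17
next s11 = byBits s29 s1 s1 s0
next s12 = byBits s8 s30 s31 s11
next s13 = byBits s32 s2 s3 s33
next s14 = byBits s34 s4 s35 s36
next s15 = byBits s29 s22 s23 s0
next s16 = byBits s23 s29 s37 s38
next s17 = byBits s6 s39 s40 s7
next s18 = byBits s6 s4 s35 s7
next s19 = byBits s29 s41 s42 s0
next s20 = byBits s23 s43 s44 s38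
next s21 = byBits s6 s5 s45 s7
next s22 = byBits s24 s1 s1 s19
next s23 = byBits s14 s1 s1 s17
next s24 = byBits s46 s22 s23 s43
next s25 = byBits s47 s25 s26 s48
next s26 = byBits s49 s27 s28 s50
next s27 = byBits s51 s30 s31 s52
next s28 = byBits s53 s32 s54 s55
next s29 = byBits s8 s1 s1 s11
next s30 = byBits s1 s25 s26 s1
next s31 = byBits s1 s27 s28 s1
next s32 = byBits s1 s30 s31 s1
next s33 = byBits s32 s1 s1 s33
next s34 = byBits s14 s24 s56 s17
next s35 = byBits s57 s12 s58 s3
next s36 = byBits s14 s19 s20 s17
next s37 = byBits s57 s1 s1 s3
next s38 = byBits s1 s19 s20 s1
next s39 = byBits s8 s2 s3 s11
next s40 = byBits s57 s11 s59 s3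
next s41 = byBits s4 s25 s26 s5
next s42 = byBits s6 s27 s28 s7
next s43 = byBits s29 s30 s31 s0
next s44 = byBits s23 s32 s54 s38
next s45 = byBits s10 s11 s59 s60
next s46 = byBits s61 s22 s23 s32
next s47 = byBits s61 s30 s31 s32
next s48 = byBits s32 s30 s31 s33
next s49 = byBits s62 s27 s28 s26
next s50 = byBits s26 s27 s28 s63
next s51 = byBits s8 s22 s23 s11
next s52 = byBits s29 s2 s3 s0
next s53 = byBits s14 s4 s35 s17
next s54 = byBits s1 s32 s54 s1
next s55 = byBits s6 s19 s20 s7
next s56 = byBits s64 s29 s37 s42
next s57 = byBits s1 s4 s35 s1
next s58 = byBits s57 s32 s54 s3
next s59 = byBits s23 s1 s1 s38
next s60 = byBits s26 s19 s20 s63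
next s61 = byBits s61 s1 s1 s32
next s62 = byBits s62 s47 s65 s26
next s63 = byBits s26 s48 s66 s63
next s64 = byBits s62 s4 s35 s26
next s65 = byBits s67 s32 s54 s31
next s66 = byBits s31 s32 s54 s68
next s67 = byBits s62 s1 s1 s26
next s68 = byBits s26 s1 s1 s63

-- In state x, a nonzero coefficient at (interleave a b , interleave c d) satisfies
-- Within (offsets p) a b c d for every allowed p, and carry x w makes the coefficient at
-- (interleave (b2n w + c) b , interleave c b) equal to 1.
allowed : State → Bound → Bool
allowed s0 = among (q0 ∷ q1 ∷ q2 ∷ q3 ∷ q7 ∷ [])
allowed s1 = among (q1 ∷ q2 ∷ q3 ∷ q4 ∷ q5 ∷ q6 ∷ q7 ∷ q8 ∷ [])
allowed s2 = among (q6 ∷ q7 ∷ [])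
allowed s3 = among (q1 ∷ q3 ∷ q4 ∷ q5 ∷ [])
allowed s4 = among (q0 ∷ q2 ∷ q3 ∷ q7 ∷ [])
allowed s5 = among (q0 ∷ q7 ∷ [])
allowed s6 = among (q1 ∷ q3 ∷ [])
allowed s7 = among (q1 ∷ q3 ∷ [])
allowed s8 = among (q1 ∷ q2 ∷ q3 ∷ q7 ∷ [])
allowed s9 = among (q6 ∷ q7 ∷ [])
allowed s10 = among (q1 ∷ q3 ∷ [])
allowed s11 = among (q1 ∷ q2 ∷ q3 ∷ q7 ∷ [])
allowed s12 = among (q2 ∷ q3 ∷ q7 ∷ [])
allowed s13 = among (q7 ∷ [])
allowed s14 = among (q1 ∷ q3 ∷ [])
allowed s15 = among (q2 ∷ q3 ∷ q7 ∷ [])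
allowed s16 = among (q3 ∷ q4 ∷ q5 ∷ [])
allowed s17 = among (q1 ∷ q3 ∷ [])
allowed s18 = among (q1 ∷ q3 ∷ [])
allowed s19 = among (q0 ∷ q2 ∷ q3 ∷ q7 ∷ [])
allowed s20 = among (q3 ∷ q4 ∷ q5 ∷ [])
allowed s21 = among (q1 ∷ q3 ∷ [])
allowed s22 = among (q6 ∷ q7 ∷ [])
allowed s23 = among (q1 ∷ q3 ∷ q4 ∷ q5 ∷ [])
allowed s24 = among (q0 ∷ q7 ∷ [])
allowed s25 = among (q6 ∷ q7 ∷ q8 ∷ [])
allowed s26 = among (q1 ∷ q2 ∷ q3 ∷ q7 ∷ [])
allowed s27 = among (q2 ∷ q3 ∷ q7 ∷ [])
allowed s28 = among (q3 ∷ q4 ∷ q5 ∷ [])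
allowed s29 = among (q1 ∷ q2 ∷ q3 ∷ q7 ∷ [])
allowed s30 = among (q6 ∷ q7 ∷ q8 ∷ [])
allowed s31 = among (q1 ∷ q3 ∷ q7 ∷ [])
allowed s32 = among (q2 ∷ q3 ∷ q7 ∷ [])
allowed s33 = among (q7 ∷ [])
allowed s34 = among (q1 ∷ q3 ∷ [])
allowed s35 = among (q3 ∷ q4 ∷ q5 ∷ [])
allowed s36 = among (q1 ∷ q3 ∷ [])
allowed s37 = among (q4 ∷ q5 ∷ [])
allowed s38 = among (q3 ∷ q4 ∷ q5 ∷ [])
allowed s39 = among (q2 ∷ q3 ∷ q7 ∷ [])
allowed s40 = among (q3 ∷ q4 ∷ q5 ∷ [])
allowed s41 = among (q6 ∷ q7 ∷ [])
allowed s42 = among (q1 ∷ q3 ∷ [])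
allowed s43 = among (q2 ∷ q3 ∷ q7 ∷ [])
allowed s44 = among (q4 ∷ q5 ∷ [])
allowed s45 = among (q3 ∷ [])
allowed s46 = among (q7 ∷ [])
allowed s47 = among (q6 ∷ q7 ∷ q8 ∷ [])
allowed s48 = among (q6 ∷ q7 ∷ q8 ∷ [])
allowed s49 = among (q1 ∷ q2 ∷ q3 ∷ q7 ∷ [])
allowed s50 = among (q1 ∷ q2 ∷ q3 ∷ q7 ∷ [])
allowed s51 = among (q7 ∷ [])
allowed s52 = among (q7 ∷ [])
allowed s53 = among (q3 ∷ [])
allowed s54 = among (q3 ∷ q4 ∷ q5 ∷ [])
allowed s55 = among (q3 ∷ [])
allowed s56 = among (q3 ∷ [])
allowed s57 = among (q3 ∷ q4 ∷ q5 ∷ [])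
allowed s58 = among (q4 ∷ q5 ∷ [])
allowed s59 = among (q4 ∷ q5 ∷ [])
allowed s60 = among (q3 ∷ [])
allowed s61 = among (q7 ∷ [])
allowed s62 = among (q1 ∷ q2 ∷ q3 ∷ q7 ∷ [])
allowed s63 = among (q1 ∷ q2 ∷ q3 ∷ q7 ∷ [])
allowed s64 = among (q3 ∷ [])
allowed s65 = among (q3 ∷ [])
allowed s66 = among (q3 ∷ [])
allowed s67 = among (q3 ∷ [])
allowed s68 = among (q3 ∷ [])

carry : State → Bool → Bool
carry s0 true = true
carry s4 true = true
carry s5 true = true
carry s6 false = true
carry s7 false = true
carry s14 false = true
carry s17 false = true
carry s18 false = true
carry s19 true = true
carry s21 false = true
carry s24 true = true
carry s34 false = true
carry s36 false = true
carry _ _ = false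

_⇒ᵇ_ : Bool → Bool → Bool
a ⇒ᵇ b = not a ∨ b

⇒ᵇ-elim : ∀ {a b} → T (a ⇒ᵇ b) → T a → T b
⇒ᵇ-elim {true} t _ = t

constantTerm : State → Bool
constantTerm x = ⟦ numerator x ⟧ 0 0

_≟ₗ_ : DecidableEquality (List Monomial)
_≟ₗ_ = List.≡-dec (Product.≡-dec _≟_ _≟_)

transitionCorrect : State → Bool → Bool → Bool
transitionCorrect x r s = isYes (nextNumerator r s (numerator x) ≟ₗ numerator (next x r s))

boundStep : State → Bound → Bool → Bool → Bool → Bool → Bool
boundStep x p α β γ η = allowed (next (next x α γ) β η) (nextBound p α β γ η)

boundClosed : State → Bound → Bool
boundClosed x p = allowed x p ⇒ᵇ (∀ᵇ⁴ (boundStep x p) ∧ (constantTerm x ⇒ᵇ withinAtOrigin (offsets p)))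

carryStep : State → Bool → Bool → Bool → Bool
carryStep x w γ β = carry (next (next x (w xor γ) γ) β β) (w ∧ γ)

carryClosed : State → Bool → Bool
carryClosed x w = carry x w ⇒ᵇ (∀ᵇ² (carryStep x w) ∧ (w ∨ constantTerm x))

Consistent : State → Set
Consistent x = T (∀ᵇ² (transitionCorrect x)) × T (∀q (boundClosed x)) × T (∀ᵇ (carryClosed x))

consistent : ∀ x → Consistent x
consistent = λ
  { s0 → tt , tt , tt ; s1 → tt , tt , tt ; s2 → tt , tt , tt ; s3 → tt , tt , tt ; s4 → tt , tt , tt ; s5 → tt , tt , tt
  ; s6 → tt , tt , tt ; s7 → tt , tt , tt ; s8 → tt , tt , tt ; s9 → tt , tt , tt ; s10 → tt , tt , tt ; s11 → tt , tt , tt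
  ; s12 → tt , tt , tt ; s13 → tt , tt , tt ; s14 → tt , tt , tt ; s15 → tt , tt , tt ; s16 → tt , tt , tt ; s17 → tt , tt , tt
  ; s18 → tt , tt , tt ; s19 → tt , tt , tt ; s20 → tt , tt , tt ; s21 → tt , tt , tt ; s22 → tt , tt , tt ; s23 → tt , tt , tt
  ; s24 → tt , tt , tt ; s25 → tt , tt , tt ; s26 → tt , tt , tt ; s27 → tt , tt , tt ; s28 → tt , tt , tt ; s29 → tt , tt , tt
  ; s30 → tt , tt , tt ; s31 → tt , tt , tt ; s32 → tt , tt , tt ; s33 → tt , tt , tt ; s34 → tt , tt , tt ; s35 → tt , tt , tt
  ; s36 → tt , tt , tt ; s37 → tt , tt , tt ; s38 → tt , tt , tt ; s39 → tt , tt , tt ; s40 → tt , tt , tt ; s41 → tt , tt , tt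
  ; s42 → tt , tt , tt ; s43 → tt , tt , tt ; s44 → tt , tt , tt ; s45 → tt , tt , tt ; s46 → tt , tt , tt ; s47 → tt , tt , tt
  ; s48 → tt , tt , tt ; s49 → tt , tt , tt ; s50 → tt , tt , tt ; s51 → tt , tt , tt ; s52 → tt , tt , tt ; s53 → tt , tt , tt
  ; s54 → tt , tt , tt ; s55 → tt , tt , tt ; s56 → tt , tt , tt ; s57 → tt , tt , tt ; s58 → tt , tt , tt ; s59 → tt , tt , tt
  ; s60 → tt , tt , tt ; s61 → tt , tt , tt ; s62 → tt , tt , tt ; s63 → tt , tt , tt ; s64 → tt , tt , tt ; s65 → tt , tt , tt
  ; s66 → tt , tt , tt ; s67 → tt , tt , tt ; s68 → tt , tt , tt
  }

next-numerator : ∀ x r s → nextNumerator r s (numerator x) ≡ numerator (next x r s)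
next-numerator x r s = toWitness (∀ᵇ²-sound (transitionCorrect x) (proj₁ (consistent x)) r s)

bound-closed : ∀ x p → T (allowed x p) → T (∀ᵇ⁴ (boundStep x p) ∧ (constantTerm x ⇒ᵇ withinAtOrigin (offsets p)))
bound-closed x p = ⇒ᵇ-elim (∀q-sound (boundClosed x) (proj₁ (proj₂ (consistent x))) p)

allowed-step : ∀ x p → T (allowed x p) → ∀ α β γ η →
  T (allowed (next (next x α γ) β η) (nextBound p α β γ η))
allowed-step x p t = ∀ᵇ⁴-sound (boundStep x p) (T-∧ˡ (bound-closed x p t))

allowed-origin : ∀ x p → T (allowed x p) → T (constantTerm x) → Within (offsets p) 0 0 0 0
allowed-origin x p t c = withinAtOrigin-sound (offsets p) (⇒ᵇ-elim (T-∧ʳ (bound-closed x p t)) c)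

carry-closed : ∀ x w → T (carry x w) → T (∀ᵇ² (carryStep x w) ∧ (w ∨ constantTerm x))
carry-closed x w = ⇒ᵇ-elim (∀ᵇ-sound (carryClosed x) (proj₂ (proj₂ (consistent x))) w)

carry-step : ∀ x w → T (carry x w) → ∀ γ β → T (carry (next (next x (w xor γ) γ) β β) (w ∧ γ))
carry-step x w t = ∀ᵇ²-sound (carryStep x w) (T-∧ˡ (carry-closed x w t))

carry-origin : ∀ x → T (carry x false) → T (constantTerm x)
carry-origin x t = T-∧ʳ (carry-closed x false t)

-- Reading coefficients of N / D off the automaton

quotient-next : ∀ x r s G → D· G ≋ ⟦ numerator x ⟧ → D· section r s G ≋ ⟦ numerator (next x r s) ⟧
quotient-next x r s G e p q =
  trans (quotient-step r s G (numerator x) e p q) (cong (λ N → ⟦ N ⟧ p q) (next-numerator x r s))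

quotient-digits : ∀ x α β γ η G → D· G ≋ ⟦ numerator x ⟧ →
  D· section β η (section α γ G) ≋ ⟦ numerator (next (next x α γ) β η) ⟧
quotient-digits x α β γ η G e = quotient-next (next x α γ) β η (section α γ G) (quotient-next x α γ G e)

section-interleave : ∀ G α β γ η a b c d →
  G (interleave (consBit α a) (consBit β b)) (interleave (consBit γ c) (consBit η d))
  ≡ section β η (section α γ G) (interleave a b) (interleave c d)
section-interleave G α β γ η a b c d = cong₂ G (interleave-consBit α β a b) (interleave-consBit γ η c d)

support-within : ∀ x p → T (allowed x p) → ∀ G → D· G ≋ ⟦ numerator x ⟧ →
  ∀ a b c d → G (interleave a b) (interleave c d) ≡ true → Within (offsets p) a b c d
support-within x p t G e a b c d = go (a + b + c + d) x p t G e
  (≤-trans (≤-trans (m≤m+n a b) (m≤m+n (a + b) c)) (m≤m+n (a + b + c) d))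
  (≤-trans (≤-trans (m≤n+m b a) (m≤m+n (a + b) c)) (m≤m+n (a + b + c) d))
  (≤-trans (m≤n+m c (a + b)) (m≤m+n (a + b + c) d)) (m≤n+m d (a + b + c))
  where
  go : ∀ f x p → T (allowed x p) → ∀ G → D· G ≋ ⟦ numerator x ⟧ → ∀ {a b c d} → a ≤ f → b ≤ f → c ≤ f → d ≤ f →
    G (interleave a b) (interleave c d) ≡ true → Within (offsets p) a b c d
  go zero x p t G e z≤n z≤n z≤n z≤n g =
    allowed-origin x p t (Equivalence.from T-≡ (trans (sym (quotient-origin G e)) g))
  go (suc f) x p t G e {a} {b} {c} {d} a≤ b≤ c≤ d≤ g with binary a | binary b | binary c | binary d
  ... | bits α a′ | bits β b′ | bits γ c′ | bits η d′ =
    within-step (offsets p) _ α β γ η (nextBound-sound p α β γ η)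
      (go f (next (next x α γ) β η) (nextBound p α β γ η) (allowed-step x p t α β γ η)
        (section β η (section α γ G)) (quotient-digits x α β γ η G e)
        (consBit≤suc⇒≤ α a≤) (consBit≤suc⇒≤ β b≤) (consBit≤suc⇒≤ γ c≤) (consBit≤suc⇒≤ η d≤)
        (trans (sym (section-interleave G α β γ η a′ b′ c′ d′)) g))

carry-consBit : ∀ w γ c → b2n w + consBit γ c ≡ consBit (w xor γ) (b2n (w ∧ γ) + c)
carry-consBit false γ     c = refl
carry-consBit true  false c = refl
carry-consBit true  true  c = refl

leading-coefficient : ∀ x w → T (carry x w) → ∀ G → D· G ≋ ⟦ numerator x ⟧ →
  ∀ c b → G (interleave (b2n w + c) b) (interleave c b) ≡ true
leading-coefficient x w t G e c b = go (b2n w + c + b) x w t G e (m≤m+n (b2n w + c) b) (m≤n+m b (b2n w + c))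
  where
  go : ∀ f x w → T (carry x w) → ∀ G → D· G ≋ ⟦ numerator x ⟧ →
    ∀ {c b} → b2n w + c ≤ f → b ≤ f → G (interleave (b2n w + c) b) (interleave c b) ≡ true
  go zero    x false t G e z≤n z≤n = trans (quotient-origin G e) (Equivalence.to T-≡ (carry-origin x t))
  go (suc f) x w t G e {c} {b} wc≤ b≤ with binary c | binary b
  ... | bits γ c′ | bits β b′ = begin
    G (interleave (b2n w + consBit γ c′) (consBit β b′)) (interleave (consBit γ c′) (consBit β b′))
      ≡⟨ cong (λ n → G (interleave n (consBit β b′)) (interleave (consBit γ c′) (consBit β b′))) (carry-consBit w γ c′) ⟩
    G (interleave (consBit (w xor γ) (b2n (w ∧ γ) + c′)) (consBit β b′)) (interleave (consBit γ c′) (consBit β b′))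
      ≡⟨ section-interleave G (w xor γ) β γ β (b2n (w ∧ γ) + c′) b′ c′ b′ ⟩
    section β β (section (w xor γ) γ G) (interleave (b2n (w ∧ γ) + c′) b′) (interleave c′ b′)
      ≡⟨ go f _ (w ∧ γ) (carry-step x w t γ β) (section β β (section (w xor γ) γ G))
            (quotient-digits x (w xor γ) β γ β G e)
            (consBit≤suc⇒≤ (w xor γ) (subst (_≤ suc f) (carry-consBit w γ c′) wc≤)) (consBit≤suc⇒≤ β b≤) ⟩
    true ∎
    where open ≡-Reasoning

-- The generating series of the family

coeff-⊕ : ∀ P Q k → coeff (P ⊕ Q) k ≡ coeff P k xor coeff Q k
coeff-⊕ []      Q       k       = refl
coeff-⊕ (a ∷ P) []      zero    = sym (xor-identityʳ a)
coeff-⊕ (a ∷ P) []      (suc k) = sym (xor-identityʳ (coeff P k))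
coeff-⊕ (a ∷ P) (b ∷ Q) zero    = refl
coeff-⊕ (a ∷ P) (b ∷ Q) (suc k) = coeff-⊕ P Q k

coeff-mono : ∀ k q → coeff (mono k) q ≡ (k ≡ᵇ q)
coeff-mono zero    zero    = refl
coeff-mono zero    (suc q) = refl
coeff-mono (suc k) zero    = refl
coeff-mono (suc k) (suc q) = coeff-mono k q

mulMono-shift : ∀ b {R p P} → (∀ q → R p q ≡ coeff P q) → ∀ q → mulMono (0 , b) R p q ≡ coeff (shift b P) q
mulMono-shift zero    e q       = e q
mulMono-shift (suc b) e zero    = refl
mulMono-shift (suc b) e (suc q) = mulMono-shift b e q

mulMono-vanish : ∀ b {R p} → (∀ q → R p q ≡ false) → ∀ q → mulMono (0 , b) R p q ≡ false
mulMono-vanish zero    e q       = e q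
mulMono-vanish (suc b) e zero    = refl
mulMono-vanish (suc b) e (suc q) = mulMono-vanish b e q

EvenFree : Series → Set
EvenFree R = ∀ m q → R (twice m) q ≡ false

mulMono-evenFree : ∀ a b {R} → EvenFree R → EvenFree (mulMono (twice a , b) R)
mulMono-evenFree zero    b e m       q = mulMono-vanish b (e m) q
mulMono-evenFree (suc a) b e zero    q = refl
mulMono-evenFree (suc a) b e (suc m) q = mulMono-evenFree a b e m q

D·-evenFree : ∀ {R} → EvenFree R → EvenFree (D· R)
D·-evenFree e m q =
  cong₂ _xor_ (e m q) (cong₂ _xor_ (mulMono-evenFree 6 4 e m q)
    (cong₂ _xor_ (mulMono-evenFree 7 2 e m q) (cong₂ _xor_ (mulMono-evenFree 8 16 e m q) refl)))

odd≢ᵇtwice : ∀ a m → T (lowBit a) → (a ≡ᵇ twice m) ≡ false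
odd≢ᵇtwice a m odd =
  trans (≡ᵇ-consBit a false m) (cong (λ r → not (r xor false) ∧ (⌊ a /2⌋ ≡ᵇ m)) (Equivalence.to T-≡ odd))

⟦⟧-evenFree : ∀ {L} → All (T ∘ lowBit ∘ proj₁) L → EvenFree ⟦ L ⟧
⟦⟧-evenFree []                              m q = refl
⟦⟧-evenFree {(a , b) ∷ L} (a-odd ∷ L-odd) m q =
  cong₂ _xor_ (cong (_∧ (b ≡ᵇ q)) (odd≢ᵇtwice a m a-odd)) (⟦⟧-evenFree L-odd m q)

-- The terms of D · generating A of x-degree at most 15; the t⁵ of A₁₅ cancels against t⁴ A₃.
initialNumerator : List Monomial
initialNumerator = (3 , 1) ∷ (7 , 5) ∷ (9 , 3) ∷ (11 , 9) ∷ (11 , 1) ∷ (13 , 7) ∷ (15 , 13) ∷ []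

initialNumerator-odd : All (T ∘ lowBit ∘ proj₁) initialNumerator
initialNumerator-odd = tt ∷ tt ∷ tt ∷ tt ∷ tt ∷ tt ∷ tt ∷ []

nextNumerator-initial₁₁ : nextNumerator true true initialNumerator ≡ numerator s0
nextNumerator-initial₁₁ = refl

nextNumerator-initial₁₀ : nextNumerator true false initialNumerator ≡ []
nextNumerator-initial₁₀ = refl

-- Hyp constrains only the odd indices, so the even ones are discarded.
generating : (ℕ → Poly) → Series
generating A p q = if lowBit p then coeff (A p) q else false

module _ (A : ℕ → Poly) where

  generating-odd : ∀ m q → generating A (consBit true m) q ≡ coeff (A (consBit true m)) q
  generating-odd m q rewrite lowBit-consBit true m = refl

  generating-evenFree : EvenFree (generating A)
  generating-evenFree m q rewrite lowBit-consBit false m = refl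

  odd-index₀ : ∀ m → 2 * m + 1 ≡ consBit true m
  odd-index₀ m = trans (+-comm (2 * m) 1) (sym (consBit≡ true m))

  odd-index : ∀ m j → 2 * m + 1 + twice j ≡ consBit true (j + m)
  odd-index m j = begin
    2 * m + 1 + twice j    ≡⟨ cong (2 * m + 1 +_) (twice≡+ j) ⟩
    2 * m + 1 + (j + j)    ≡⟨ regroup m j ⟩
    1 + 2 * (j + m)        ≡⟨ sym (consBit≡ true (j + m)) ⟩
    consBit true (j + m)   ∎
    where
    open ≡-Reasoning
    regroup : ∀ m j → 2 * m + 1 + (j + j) ≡ 1 + 2 * (j + m)
    regroup = solve-∀

  recurrence : Hyp A → ∀ m q → coeff (A (consBit true (8 + m))) q ≡
    (coeff (shift 16 (A (consBit true m))) q xor coeff (shift 4 (A (consBit true (2 + m)))) q)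
      xor coeff (shift 2 (A (consBit true (1 + m)))) q
  recurrence (rec , _) m q = begin
    coeff (A (consBit true (8 + m))) q
      ≡⟨ cong (λ n → coeff (A n) q) (sym (odd-index m 8)) ⟩
    coeff (A (2 * m + 1 + 16)) q
      ≡⟨ rec m q ⟩
    coeff (S 16 (2 * m + 1) ⊕ S 4 (2 * m + 1 + 4) ⊕ S 2 (2 * m + 1 + 2)) q
      ≡⟨ coeff-⊕ (S 16 (2 * m + 1) ⊕ S 4 (2 * m + 1 + 4)) (S 2 (2 * m + 1 + 2)) q ⟩
    coeff (S 16 (2 * m + 1) ⊕ S 4 (2 * m + 1 + 4)) q xor coeff (S 2 (2 * m + 1 + 2)) q
      ≡⟨ cong (_xor coeff (S 2 (2 * m + 1 + 2)) q) (coeff-⊕ (S 16 (2 * m + 1)) (S 4 (2 * m + 1 + 4)) q) ⟩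
    (coeff (S 16 (2 * m + 1)) q xor coeff (S 4 (2 * m + 1 + 4)) q) xor coeff (S 2 (2 * m + 1 + 2)) q
      ≡⟨ cong₂ (λ i j → (coeff (S 16 i) q xor coeff (S 4 j) q) xor coeff (S 2 (2 * m + 1 + 2)) q)
               (odd-index₀ m) (odd-index m 2) ⟩
    (coeff (S 16 (consBit true m)) q xor coeff (S 4 (consBit true (2 + m))) q) xor coeff (S 2 (2 * m + 1 + 2)) q
      ≡⟨ cong (λ k → (coeff (S 16 (consBit true m)) q xor coeff (S 4 (consBit true (2 + m))) q) xor coeff (S 2 k) q)
              (odd-index m 1) ⟩
    (coeff (S 16 (consBit true m)) q xor coeff (S 4 (consBit true (2 + m))) q)
      xor coeff (S 2 (consBit true (1 + m))) q ∎
    where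
    open ≡-Reasoning
    S : ℕ → ℕ → Poly
    S b n = shift b (A n)

  D·generating-odd : Hyp A → ∀ m q → (D· generating A) (consBit true m) q ≡ ⟦ initialNumerator ⟧ (consBit true m) q
  D·generating-odd (_ , A₁ , _) 0 q rewrite A₁ q = refl
  D·generating-odd (_ , _ , A₃ , _) 1 q rewrite A₃ q | coeff-mono 1 q = refl
  D·generating-odd (_ , _ , _ , A₅ , _) 2 q rewrite A₅ q = refl
  D·generating-odd (_ , _ , _ , _ , A₇ , _) 3 q rewrite A₇ q | coeff-mono 5 q = refl
  D·generating-odd (_ , _ , _ , _ , _ , A₉ , _) 4 q rewrite A₉ q | coeff-mono 3 q = refl
  D·generating-odd (_ , _ , _ , _ , _ , _ , A₁₁ , _) 5 q
    rewrite A₁₁ q | coeff-⊕ (mono 9) (mono 1) q | coeff-mono 9 q | coeff-mono 1 q = xor-assoc (9 ≡ᵇ q) (1 ≡ᵇ q) false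
  D·generating-odd (_ , A₁ , _ , _ , _ , _ , _ , A₁₃ , _) 6 q
    rewrite A₁₃ q | coeff-mono 7 q = cong (λ z → (7 ≡ᵇ q) xor (z xor false)) (mulMono-vanish 4 A₁ q)
  D·generating-odd (_ , A₁ , A₃ , _ , _ , _ , _ , _ , A₁₅) 7 q
    rewrite A₁₅ q | coeff-⊕ (mono 13) (mono 5) q | coeff-mono 13 q | coeff-mono 5 q =
    trans (cong₂ (λ y z → ((13 ≡ᵇ q) xor (5 ≡ᵇ q)) xor (y xor (z xor false)))
                 (trans (mulMono-shift 4 A₃ q) (coeff-mono 5 q)) (mulMono-vanish 2 A₁ q))
          (xor-cancelˡ (13 ≡ᵇ q) (5 ≡ᵇ q) false)
  D·generating-odd hyp (suc (suc (suc (suc (suc (suc (suc (suc m)))))))) q =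
    trans (cong₂ _xor_ (trans (generating-odd (8 + m) q) (recurrence hyp m q))
            (cong₂ _xor_ (mulMono-shift 4 (generating-odd (2 + m)) q)
              (cong₂ _xor_ (mulMono-shift 2 (generating-odd (1 + m)) q)
                (cong₂ _xor_ (mulMono-shift 16 (generating-odd m) q) refl))))
          (xor-cancel₃ (coeff (shift 16 (A (consBit true m))) q) (coeff (shift 4 (A (consBit true (2 + m)))) q)
                       (coeff (shift 2 (A (consBit true (1 + m)))) q))

  D·generating : Hyp A → D· generating A ≋ ⟦ initialNumerator ⟧
  D·generating hyp p q with binary p
  ... | bits false m =
    trans (D·-evenFree {generating A} generating-evenFree m q) (sym (⟦⟧-evenFree initialNumerator-odd m q))
  ... | bits true  m = D·generating-odd hyp m q

precedes-or-equal : ∀ {a b c d} → c + d ≡ a + b → d ≤ b → (c , d) ≡ (a , b) ⊎ Precedes (c , d) (a , b)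
precedes-or-equal {a} {b} {c} {d} eq d≤b with m≤n⇒m<n∨m≡n d≤b
... | inj₁ d<b  = inj₂ (inj₂ (eq , d<b))
... | inj₂ refl = inj₁ (cong (_, d) (+-cancelʳ-≡ d c a eq))

within-q0-suc : ∀ {a b c d} → Within (offsets q0) (suc a) b c d → (c , d) ≡ (a , b) ⊎ Precedes (c , d) (a , b)
within-q0-suc {a} {b} {c} {d} (inj₁ lt) =
  inj₂ (inj₁ (≤-pred (subst₂ _≤_ (cong suc (+-comm (c + d) 1)) (+-identityʳ (suc a + b)) lt)))
within-q0-suc {a} {b} {c} {d} (inj₂ (eq , le)) =
  precedes-or-equal (suc-injective (trans (+-comm 1 (c + d)) (trans eq (+-identityʳ (suc a + b)))))
                    (subst₂ _≤_ (+-identityʳ d) (+-identityʳ b) le)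

within-q0-zero : ∀ {b c d} → Within (offsets q0) 0 b c d →
  ∃[ b′ ] (b ≡ suc b′ × ((c , d) ≡ (0 , b′) ⊎ Precedes (c , d) (0 , b′)))
within-q0-zero {zero}   {c} {d} (inj₁ lt) with () ← subst (_≤ 0) (cong suc (+-comm (c + d) 1)) lt
within-q0-zero {zero}   {c} {d} (inj₂ (eq , _)) with () ← trans (+-comm 1 (c + d)) eq
within-q0-zero {suc b′} {c} {d} (inj₁ lt) =
  b′ , refl , inj₂ (inj₁ (≤-pred (subst₂ _≤_ (cong suc (+-comm (c + d) 1)) (+-identityʳ (suc b′)) lt)))
within-q0-zero {suc b′} {c} {d} (inj₂ (eq , _)) =
  b′ , refl , precedes-or-equal c+d≡b′ (subst (d ≤_) c+d≡b′ (m≤n+m d c))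
  where
  c+d≡b′ : c + d ≡ b′
  c+d≡b′ = suc-injective (trans (+-comm 1 (c + d)) (trans eq (+-identityʳ (suc b′))))

module _ (A : ℕ → Poly) (hyp : Hyp A) where

  coeff-br : ∀ a b k → coeff (A (br a b)) k ≡ generating A (consBit true (interleave a b)) k
  coeff-br a b k =
    trans (cong (λ n → coeff (A n) k) (br≡consBit-interleave a b)) (sym (generating-odd A (interleave a b) k))

  D·section₁₁ : D· section true true (generating A) ≋ ⟦ numerator s0 ⟧
  D·section₁₁ p q = trans (quotient-step true true (generating A) initialNumerator (D·generating A hyp) p q)
                        (cong (λ N → ⟦ N ⟧ p q) nextNumerator-initial₁₁)

  D·section₁₀ : D· section true false (generating A) ≋ 0ˢ
  D·section₁₀ p q = trans (quotient-step true false (generating A) initialNumerator (D·generating A hyp) p q)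
                         (cong (λ N → ⟦ N ⟧ p q) nextNumerator-initial₁₀)

  coeff-even : ∀ a b K → coeff (A (br a b)) (consBit false K) ≡ false
  coeff-even a b K =
    trans (coeff-br a b (consBit false K)) (quotient-zero (section true false (generating A)) D·section₁₀ (interleave a b) K)

  coeff-odd-within : ∀ a b c d → coeff (A (br a b)) (consBit true (interleave c d)) ≡ true → Within (offsets q0) a b c d
  coeff-odd-within a b c d e =
    support-within s0 q0 tt (section true true (generating A)) D·section₁₁ a b c d
      (trans (sym (coeff-br a b (consBit true (interleave c d)))) e)

  coeff-within : ∀ a b k → coeff (A (br a b)) k ≡ true → ∃[ c ] ∃[ d ] (k ≡ br c d × Within (offsets q0) a b c d)
  coeff-within a b k e with binary k
  ... | bits false K = contradiction (trans (sym (coeff-even a b K)) e) λ ()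
  ... | bits true K with interleave-surjective K
  ...   | c , d , refl = c , d , sym (br≡consBit-interleave c d) , coeff-odd-within a b c d e

  coeff-leading : ∀ a b → coeff (A (br (suc a) b)) (br a b) ≡ true
  coeff-leading a b = begin
    coeff (A (br (suc a) b)) (br a b)
      ≡⟨ coeff-br (suc a) b (br a b) ⟩
    generating A (consBit true (interleave (suc a) b)) (br a b)
      ≡⟨ cong (generating A (consBit true (interleave (suc a) b))) (br≡consBit-interleave a b) ⟩
    section true true (generating A) (interleave (1 + a) b) (interleave a b)
      ≡⟨ leading-coefficient s0 true tt (section true true (generating A)) D·section₁₁ a b ⟩
    true ∎
    where open ≡-Reasoning

  coeff-precedes-suc : ∀ a b k → coeff (A (br (suc a) b)) k ≡ true → k ≢ br a b →
    ∃[ c ] ∃[ d ] (k ≡ br c d × Precedes (c , d) (a , b))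
  coeff-precedes-suc a b k e k≢ with coeff-within (suc a) b k e
  ... | c , d , refl , w with within-q0-suc {a} {b} {c} {d} w
  ...   | inj₁ refl = ⊥-elim (k≢ refl)
  ...   | inj₂ p    = c , d , refl , p

  coeff-precedes-zero : ∀ b k → coeff (A (br 0 b)) k ≡ true →
    ∃[ b′ ] (b ≡ suc b′ × ∃[ c ] ∃[ d ] (k ≡ br c d × ((c , d) ≡ (0 , b′) ⊎ Precedes (c , d) (0 , b′))))
  coeff-precedes-zero b k e with coeff-within 0 b k e
  ... | c , d , k≡ , w with within-q0-zero {b} {c} {d} w
  ...   | b′ , b≡ , p = b′ , b≡ , c , d , k≡ , p

corollary4p2 : (A : ℕ → Poly) → Hyp A →
    (a b : ℕ) →
      (((a' : ℕ) → a ≡ suc a' →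
          (coeff (A (br a b)) (br a' b) ≡ true)
          × (∀ k → coeff (A (br a b)) k ≡ true → k ≢ br a' b →
               ∃[ c ] ∃[ d ] (k ≡ br c d × Precedes (c , d) (a' , b))))
      × (a ≡ zero →
          ∀ k → coeff (A (br a b)) k ≡ true →
            ∃[ b' ] (b ≡ suc b' ×
              ∃[ c ] ∃[ d ] (k ≡ br c d
                × (((c , d) ≡ (zero , b')) ⊎ Precedes (c , d) (zero , b'))))))
corollary4p2 A hyp a b =
    (λ { a′ refl → coeff-leading A hyp a′ b , coeff-precedes-suc A hyp a′ b })
  , λ { refl → coeff-precedes-zero A hyp b }
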